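{- Let $k,n,m$ be integers with $2\leq k<n\leq m$, and let $F$ be a graph with a cut-edge $e$ such that the components of $F-e$ are $G\cong K_n$ and $H\cong K_m$. Then \[ \gamma_{\times k,t}(F_I)=\begin{cases} \gamma_{\times k,t}(G_I)+\gamma_{\times k,t}(H_I)-2 & \text{if } k,\ m \text{ and } n \text{ are all odd},\\ \gamma_{\times k,t}(G_I)+\gamma_{\times k,t}(H_I) & \text{otherwise.}\end{cases} \]
   Context: All graphs are finite, simple and undirected. For a graph $G$ without isolated vertices, the inflated graph $G_I$ is obtained as follows: each vertex $x_i$ of $G$ of degree $d(x_i)$ is replaced by a clique $X_i\cong K_{d(x_i)}$ whose vertices are labelled $x_ix_j$, one for each neighbour $x_j$ of $x_i$; and each edge $x_ix_j$ of $G$ is replaced by the edge joining $x_ix_j\in X_i$ to $x_jx_i\in X_j$. For an integer $k\geq1$, a set $S\subseteq V(H)$ is a $k$-tuple total dominating set of a graph $H$ if every vertex of $H$ has at least $k$ neighbours in $S$; $\gamma_{\times k,t}(H)$ denotes the minimum cardinality of such a set. -}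

module Defs where

open import Data.Nat using (ℕ; _≤_; _%_)
open import Data.Bool using (Bool; true; false; _∧_; _∨_; not; T)
open import Data.Fin using (Fin)
open import Data.Fin.Properties renaming (_≟_ to _≟F_)
open import Data.Sum using (_⊎_; inj₁; inj₂)
open import Data.Sum.Properties using (≡-dec)
open import Data.Product using (Σ; _×_; _,_; ∃; ∃-syntax)
import Data.Product.Properties
open import Data.List using (List; length; filter)
open import Data.List.Relation.Unary.Unique.Propositional using (Unique)
open import Relation.Nullary using (Dec; yes; no; ⌊_⌋)
open import Relation.Binary.PropositionalEquality using (_≡_)
open import Relation.Binary.Definitions using (DecidableEquality)

-- A graph: vertex type with decidable equality and a Boolean adjacency.
-- (All concrete graphs constructed below are finite, simple and undirected.)
record Graph : Set₁ where
  field
    V    : Set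
    _≟V_ : DecidableEquality V
    adj  : V → V → Bool
open Graph public

-- The inflated graph G_I: vertices are the ordered pairs (x , y) with x ~ y
-- (the vertex "x y" of the clique X_x); "x y" ~ "x' y'" iff they lie in the
-- same clique (x = x', y ≠ y') or they come from the edge xy (x = y', y = x').
Inflated : Graph → Graph
Inflated G = record
  { V    = Σ (V G × V G) (λ { (x , y) → T (adj G x y) })
  ; _≟V_ = decI
  ; adj  = adjI
  }
  where
  eq : V G → V G → Bool
  eq a b = ⌊ (G ≟V a) b ⌋
  adjI : Σ (V G × V G) (λ { (x , y) → T (adj G x y) }) →
         Σ (V G × V G) (λ { (x , y) → T (adj G x y) }) → Bool
  adjI ((x , y) , _) ((x' , y') , _) =
    (eq x x' ∧ not (eq y y')) ∨ (eq x y' ∧ eq y x')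
  decI : DecidableEquality (Σ (V G × V G) (λ { (x , y) → T (adj G x y) }))
  decI = Data.Product.Properties.≡-dec
           (Data.Product.Properties.≡-dec (_≟V_ G) (_≟V_ G))
           (λ p q → yes (T-irr p q))
    where
    T-irr : ∀ {b} (p q : T b) → p ≡ q
    T-irr {true} _ _ = Relation.Binary.PropositionalEquality.refl

nbrsIn : (G : Graph) → V G → List (V G) → ℕ
nbrsIn G v S = length (filter (λ u → T? (adj G v u)) S)
  where
  T? : (b : Bool) → Dec (T b)
  T? b = Data.Bool.T? b

IsKTDS : (G : Graph) → ℕ → List (V G) → Set
IsKTDS G k S = Unique S × (∀ v → k ≤ nbrsIn G v S)

IsγKT : (G : Graph) → ℕ → ℕ → Set
IsγKT G k s = (∃[ S ] (IsKTDS G k S × length S ≡ s))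
            × (∀ S → IsKTDS G k S → s ≤ length S)

K : ℕ → Graph
K n = record { V = Fin n ; _≟V_ = _≟F_ ; adj = λ i j → not ⌊ i ≟F j ⌋ }

Bridge : (n m : ℕ) → Fin n → Fin m → Graph
Bridge n m a b = record { V = Fin n ⊎ Fin m ; _≟V_ = ≡-dec _≟F_ _≟F_ ; adj = ad }
  where
  ad : Fin n ⊎ Fin m → Fin n ⊎ Fin m → Bool
  ad (inj₁ i) (inj₁ j) = not ⌊ i ≟F j ⌋
  ad (inj₂ i) (inj₂ j) = not ⌊ i ≟F j ⌋
  ad (inj₁ i) (inj₂ j) = ⌊ i ≟F a ⌋ ∧ ⌊ j ≟F b ⌋
  ad (inj₂ j) (inj₁ i) = ⌊ i ≟F a ⌋ ∧ ⌊ j ≟F b ⌋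

Odd : ℕ → Set
Odd n = n % 2 ≡ 1

module Submission where

-- Both sides of the corollary are computed exactly: for 2 ≤ k < n ≤ m,
-- γ_{×k,t}((K_n)_I) = ⌈ k n ⌉₂ and γ_{×k,t}(F_I) = ⌈ k (n + m) ⌉₂, where ⌈ N ⌉₂
-- is the least even number ≥ N; the corollary is then arithmetic on ⌈_⌉₂.
--
-- Lower bound (module Inflation.LowerBound): in G_I, |N(xy) ∩ S| + [xy ∈ S] =
-- |S ∩ X_x| + [yx ∈ S], so a k-tuple total dominating set S meets every clique
-- X_x in ≥ k vertices; if |S| = k |V(G)|, S is closed under the fixed-point-free
-- involution xy ↦ yx and hence even.
-- Upper bound (module Inflation.Selection): choosing for each x a set R(x) of
-- ≥ k neighbours, reciprocated unless |R(x)| > k (a row system), the vertices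
-- {xy : y ∈ R(x)} dominate.  Optimal row systems on K_n are circulants (module
-- Circulant); on F they are two such systems side by side or, when k, n, m are
-- all odd, two systems with degree k − 1 at the ends of the cut-edge, joined
-- through it.

open import Defs
open import Data.Nat using (ℕ; zero; suc; _+_; _*_; _∸_; _≤_; _<_; z≤n; s≤s; _%_; _<?_; NonZero; >-nonZero; parity; pred)
open import Data.Nat.Properties
open import Data.Nat.DivMod using (m%n<n; m%n%n≡m%n; [m+n]%n≡m%n; %-distribˡ-+; m<n⇒m%n≡m)
open import Data.Parity.Base using (Parity; 0ℙ; 1ℙ) renaming (_+_ to _+ℙ_; _*_ to _*ℙ_)
open import Data.Parity.Properties using (+-homo-+; *-homo-*) renaming (_≟_ to _≟ℙ_)
open import Data.Fin using (Fin; toℕ; fromℕ<) renaming (zero to fzero; suc to fsuc)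
open import Data.Fin.Properties using (toℕ-fromℕ<; toℕ-injective; toℕ<n) renaming (_≟_ to _≟F_)
open import Data.Bool using (Bool; true; false; _∧_; _∨_; not; T)
open import Data.Bool.Properties using (T-irrelevant)
open import Data.Product using (Σ; Σ-syntax; _×_; _,_; ∃; ∃-syntax; proj₁; proj₂)
open import Data.Sum using (_⊎_; inj₁; inj₂)
open import Data.Empty using (⊥; ⊥-elim)
open import Data.Unit using (tt)
open import Data.List using (List; []; _∷_; length; map; _++_; filter; allFin; applyUpTo)
import Data.List.Properties as LP
import Data.List.Relation.Unary.All as All
open import Data.List.Relation.Unary.Any using (here; there)
open import Data.List.Relation.Unary.AllPairs using ([]; _∷_)
open import Data.List.Relation.Unary.Unique.Propositional using (Unique)
import Data.List.Relation.Unary.Unique.Propositional.Properties as UP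
open import Data.List.Membership.Propositional using (_∈_; _∉_)
import Data.List.Membership.Propositional.Properties as MP
open import Relation.Nullary using (Dec; yes; no; ⌊_⌋; ¬_)
open import Relation.Nullary.Decidable using (toWitness; fromWitness; _×-dec_)
open import Relation.Binary.PropositionalEquality
open import Relation.Binary.Definitions using (DecidableEquality; tri<; tri≈; tri>)
open import Algebra.Properties.CommutativeSemigroup +-commutativeSemigroup using (interchange)

⟦_⟧ : Bool → ℕ
⟦ true ⟧ = 1
⟦ false ⟧ = 0

isYes-true : {P : Set} (d : Dec P) → P → ⌊ d ⌋ ≡ true
isYes-true (yes _) _ = refl
isYes-true (no ¬p) p = ⊥-elim (¬p p)

isYes-false : {P : Set} (d : Dec P) → ¬ P → ⌊ d ⌋ ≡ false
isYes-false (yes p) ¬p = ⊥-elim (¬p p)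
isYes-false (no _) _ = refl

module _ {A : Set} where

  count : (A → Bool) → List A → ℕ
  count P [] = 0
  count P (x ∷ xs) = ⟦ P x ⟧ + count P xs

  length-filter : (P : A → Bool) (xs : List A) →
    length (filter (λ u → Data.Bool.T? (P u)) xs) ≡ count P xs
  length-filter P [] = refl
  length-filter P (x ∷ xs) with P x
  ... | true = cong suc (length-filter P xs)
  ... | false = length-filter P xs

  count-const-true : (xs : List A) → count (λ _ → true) xs ≡ length xs
  count-const-true [] = refl
  count-const-true (x ∷ xs) = cong suc (count-const-true xs)

  count-pointwise : (P Q R S : A → Bool) (xs : List A) →
    (∀ u → u ∈ xs → ⟦ P u ⟧ + ⟦ Q u ⟧ ≡ ⟦ R u ⟧ + ⟦ S u ⟧) →
    count P xs + count Q xs ≡ count R xs + count S xs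
  count-pointwise P Q R S [] h = refl
  count-pointwise P Q R S (x ∷ xs) h = begin
    (⟦ P x ⟧ + count P xs) + (⟦ Q x ⟧ + count Q xs) ≡⟨ interchange ⟦ P x ⟧ _ _ _ ⟩
    (⟦ P x ⟧ + ⟦ Q x ⟧) + (count P xs + count Q xs)
      ≡⟨ cong₂ _+_ (h x (here refl)) (count-pointwise P Q R S xs (λ u m → h u (there m))) ⟩
    (⟦ R x ⟧ + ⟦ S x ⟧) + (count R xs + count S xs) ≡⟨ interchange ⟦ R x ⟧ _ _ _ ⟩
    (⟦ R x ⟧ + count R xs) + (⟦ S x ⟧ + count S xs) ∎
    where open ≡-Reasoning

  count-mono : (P Q : A → Bool) (xs : List A) →
    (∀ u → u ∈ xs → T (P u) → T (Q u)) → count P xs ≤ count Q xs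
  count-mono P Q [] h = z≤n
  count-mono P Q (x ∷ xs) h with P x | Q x | h x (here refl)
  ... | true | true | _ = s≤s (count-mono P Q xs (λ u m → h u (there m)))
  ... | true | false | f = ⊥-elim (f tt)
  ... | false | true | _ = m≤n⇒m≤1+n (count-mono P Q xs (λ u m → h u (there m)))
  ... | false | false | _ = count-mono P Q xs (λ u m → h u (there m))

  count-witness : (P : A → Bool) (xs : List A) → 1 ≤ count P xs → ∃[ u ] (u ∈ xs × T (P u))
  count-witness P (x ∷ xs) h with P x in eq
  ... | true = x , here refl , subst T (sym eq) tt
  ... | false = let (u , m , t) = count-witness P xs h in u , there m , t

  count-positive : (P : A → Bool) (xs : List A) (u : A) → u ∈ xs → T (P u) → 1 ≤ count P xs
  count-positive P (x ∷ xs) u (here refl) t with P x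
  ... | true = s≤s z≤n
  count-positive P (x ∷ xs) u (there m) t =
    ≤-trans (count-positive P xs u m t) (m≤n+m (count P xs) ⟦ P x ⟧)

  count-ext : (P Q : A → Bool) (xs : List A) → (∀ u → u ∈ xs → P u ≡ Q u) → count P xs ≡ count Q xs
  count-ext P Q [] h = refl
  count-ext P Q (x ∷ xs) h =
    cong₂ _+_ (cong ⟦_⟧ (h x (here refl))) (count-ext P Q xs (λ u m → h u (there m)))

  count-none : (P : A → Bool) (xs : List A) → (∀ u → u ∈ xs → P u ≡ false) → count P xs ≡ 0
  count-none P [] h = refl
  count-none P (x ∷ xs) h rewrite h x (here refl) = count-none P xs (λ u m → h u (there m))

  count-++ : (P : A → Bool) (xs ys : List A) → count P (xs ++ ys) ≡ count P xs + count P ys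
  count-++ P [] ys = refl
  count-++ P (x ∷ xs) ys rewrite count-++ P xs ys = sym (+-assoc ⟦ P x ⟧ (count P xs) (count P ys))

  count-complement : (P : A → Bool) (xs : List A) →
    length xs ≡ count P xs + count (λ u → not (P u)) xs
  count-complement P [] = refl
  count-complement P (x ∷ xs) with P x
  ... | true = cong suc (count-complement P xs)
  ... | false = trans (cong suc (count-complement P xs)) (sym (+-suc (count P xs) _))

  sumOver : (A → ℕ) → List A → ℕ
  sumOver f [] = 0
  sumOver f (x ∷ xs) = f x + sumOver f xs

  sumOver-+ : (f g : A → ℕ) (xs : List A) →
    sumOver (λ x → f x + g x) xs ≡ sumOver f xs + sumOver g xs
  sumOver-+ f g [] = refl
  sumOver-+ f g (x ∷ xs) rewrite sumOver-+ f g xs = interchange (f x) (g x) (sumOver f xs) (sumOver g xs)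

  sumOver-ext : (f g : A → ℕ) (xs : List A) → (∀ x → x ∈ xs → f x ≡ g x) → sumOver f xs ≡ sumOver g xs
  sumOver-ext f g [] h = refl
  sumOver-ext f g (x ∷ xs) h = cong₂ _+_ (h x (here refl)) (sumOver-ext f g xs (λ y m → h y (there m)))

  sumOver-++ : (f : A → ℕ) (xs ys : List A) → sumOver f (xs ++ ys) ≡ sumOver f xs + sumOver f ys
  sumOver-++ f [] ys = refl
  sumOver-++ f (x ∷ xs) ys rewrite sumOver-++ f xs ys = sym (+-assoc (f x) (sumOver f xs) (sumOver f ys))

  sumOver-zero : (f : A → ℕ) (xs : List A) → (∀ x → x ∈ xs → f x ≡ 0) → sumOver f xs ≡ 0
  sumOver-zero f [] h = refl
  sumOver-zero f (x ∷ xs) h rewrite h x (here refl) = sumOver-zero f xs (λ y m → h y (there m))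

  sumOver-const : (k : ℕ) (f : A → ℕ) (xs : List A) → (∀ x → x ∈ xs → f x ≡ k) →
    sumOver f xs ≡ k * length xs
  sumOver-const k f [] h = sym (*-zeroʳ k)
  sumOver-const k f (x ∷ xs) h rewrite h x (here refl) | sumOver-const k f xs (λ y m → h y (there m)) =
    sym (*-suc k (length xs))

  sumOver-lower : (k : ℕ) (f : A → ℕ) (xs : List A) → (∀ x → x ∈ xs → k ≤ f x) → k * length xs ≤ sumOver f xs
  sumOver-lower k f [] h = ≤-reflexive (*-zeroʳ k)
  sumOver-lower k f (x ∷ xs) h =
    subst (_≤ (f x + sumOver f xs)) (sym (*-suc k (length xs)))
      (+-mono-≤ (h x (here refl)) (sumOver-lower k f xs (λ y m → h y (there m))))

  sumOver-tight : (k : ℕ) (f : A → ℕ) (xs : List A) → (∀ x → x ∈ xs → k ≤ f x) →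
    sumOver f xs ≡ k * length xs → ∀ x → x ∈ xs → f x ≡ k
  sumOver-tight k f (y ∷ xs) h e x m = go m
    where
    e' : f y + sumOver f xs ≡ k + k * length xs
    e' = trans e (*-suc k (length xs))
    rest-lower : k * length xs ≤ sumOver f xs
    rest-lower = sumOver-lower k f xs (λ z m → h z (there m))
    head-tight : f y ≡ k
    head-tight = ≤-antisym
      (+-cancelʳ-≤ (sumOver f xs) (f y) k (≤-trans (≤-reflexive e') (+-monoʳ-≤ k rest-lower)))
      (h y (here refl))
    rest-tight : sumOver f xs ≡ k * length xs
    rest-tight = +-cancelˡ-≡ k _ _ (trans (cong (_+ sumOver f xs) (sym head-tight)) e')
    go : x ∈ (y ∷ xs) → f x ≡ k
    go (here refl) = head-tight
    go (there m) = sumOver-tight k f xs (λ z m → h z (there m)) rest-tight x m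

sumOver-map : {A B : Set} (f : B → ℕ) (g : A → B) (xs : List A) →
  sumOver f (map g xs) ≡ sumOver (λ x → f (g x)) xs
sumOver-map f g [] = refl
sumOver-map f g (x ∷ xs) = cong (f (g x) +_) (sumOver-map f g xs)

module Occurrences {A : Set} (_≟_ : DecidableEquality A) where

  occ : A → List A → ℕ
  occ w xs = count (λ u → ⌊ w ≟ u ⌋) xs

  occ-≤1 : (w : A) (xs : List A) → Unique xs → occ w xs ≤ 1
  occ-≤1 w [] u = z≤n
  occ-≤1 w (x ∷ xs) (x∉xs ∷ u) with w ≟ x
  ... | yes refl = s≤s (≤-reflexive (count-none _ xs (λ v m → isYes-false (w ≟ v) (All.lookup x∉xs m))))
  ... | no _ = occ-≤1 w xs u

  occ-∈ : (w : A) (xs : List A) → w ∈ xs → 1 ≤ occ w xs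
  occ-∈ w xs m = count-positive _ xs w m (subst T (sym (isYes-true (w ≟ w) refl)) tt)

  occ-∈⁻ : (w : A) (xs : List A) → 1 ≤ occ w xs → w ∈ xs
  occ-∈⁻ w xs h with count-witness _ xs h
  ... | u , m , t = subst (_∈ xs) (sym (toWitness t)) m

  occ-unique : (xs : List A) → (∀ w → occ w xs ≤ 1) → Unique xs
  occ-unique [] h = []
  occ-unique (x ∷ xs) h =
    All.tabulate (λ {y} m e → x∉xs y m e) ∷ occ-unique xs (λ w → ≤-trans (m≤n+m _ ⟦ ⌊ w ≟ x ⌋ ⟧) (h w))
    where
    no-later : occ x xs ≡ 0
    no-later = n≤0⇒n≡0 (≤-pred (subst (_≤ 1) (cong (λ b → ⟦ b ⟧ + occ x xs) (isYes-true (x ≟ x) refl)) (h x)))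
    x∉xs : ∀ y → y ∈ xs → x ≡ y → ⊥
    x∉xs y m refl with subst (1 ≤_) no-later (occ-∈ x xs m)
    ... | ()

  sumOver-single : (f : A → ℕ) (xs : List A) (x0 : A) → Unique xs → x0 ∈ xs →
    (∀ x → ¬ x ≡ x0 → f x ≡ 0) → sumOver f xs ≡ f x0
  sumOver-single f (x ∷ xs) x0 (x∉xs ∷ u) (here refl) h =
    trans (cong (f x +_) (sumOver-zero f xs (λ y m → h y (λ e → All.lookup x∉xs m (sym e))))) (+-identityʳ (f x))
  sumOver-single f (x ∷ xs) x0 (x∉xs ∷ u) (there m) h =
    trans (cong (_+ sumOver f xs) (h x (λ e → All.lookup x∉xs m e))) (sumOver-single f xs x0 u m h)

  length-by-key : {B : Set} (key : B → A) (vs : List A) → Unique vs → (∀ x → x ∈ vs) →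
    (S : List B) → length S ≡ sumOver (λ x → count (λ u → ⌊ x ≟ key u ⌋) S) vs
  length-by-key key vs uv cv [] = sym (sumOver-zero _ vs (λ _ _ → refl))
  length-by-key key vs uv cv (u ∷ S) =
    trans (cong₂ _+_ (sym one) (length-by-key key vs uv cv S))
          (sym (sumOver-+ (λ x → ⟦ ⌊ x ≟ key u ⌋ ⟧) (λ x → count (λ u → ⌊ x ≟ key u ⌋) S) vs))
    where
    one : sumOver (λ x → ⟦ ⌊ x ≟ key u ⌋ ⟧) vs ≡ 1
    one = trans (sumOver-single _ vs (key u) uv (cv (key u)) (λ x ne → cong ⟦_⟧ (isYes-false (x ≟ key u) ne)))
                (cong ⟦_⟧ (isYes-true (key u ≟ key u) refl))

module _ {A : Set} where

  private
    remove : ∀ {u : A} (ys : List A) → u ∈ ys → List A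
    remove (y ∷ ys) (here _) = ys
    remove (y ∷ ys) (there m) = y ∷ remove ys m

    length-remove : ∀ {u : A} (ys : List A) (m : u ∈ ys) → length ys ≡ suc (length (remove ys m))
    length-remove (y ∷ ys) (here _) = refl
    length-remove (y ∷ ys) (there m) = cong suc (length-remove ys m)

    ∈-remove : ∀ {u z : A} (ys : List A) (m : u ∈ ys) → z ∈ ys → ¬ z ≡ u → z ∈ remove ys m
    ∈-remove (y ∷ ys) (here refl) (here refl) ne = ⊥-elim (ne refl)
    ∈-remove (y ∷ ys) (here refl) (there mz) ne = mz
    ∈-remove (y ∷ ys) (there m) (here refl) ne = here refl
    ∈-remove (y ∷ ys) (there m) (there mz) ne = there (∈-remove ys m mz ne)

  unique-⊆-length : (xs ys : List A) → Unique xs → (∀ z → z ∈ xs → z ∈ ys) → length xs ≤ length ys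
  unique-⊆-length [] ys u h = z≤n
  unique-⊆-length (x ∷ xs) ys (x∉xs ∷ u) h =
    subst (suc (length xs) ≤_) (sym (length-remove ys x∈ys))
      (s≤s (unique-⊆-length xs (remove ys x∈ys) u
        (λ z mz → ∈-remove ys x∈ys (h z (there mz)) (λ e → All.lookup x∉xs mz (sym e)))))
    where
    x∈ys = h x (here refl)

map-unique : {A B : Set} (f : A → B) (xs : List A) → Unique xs →
  (∀ a b → a ∈ xs → b ∈ xs → f a ≡ f b → a ≡ b) → Unique (map f xs)
map-unique f [] u h = []
map-unique f (x ∷ xs) (x∉xs ∷ u) h =
  All.tabulate (λ {w} m e → fresh w m e) ∷ map-unique f xs u (λ a b ma mb → h a b (there ma) (there mb))
  where
  fresh : ∀ w → w ∈ map f xs → f x ≡ w → ⊥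
  fresh w m e with MP.∈-map⁻ f m
  ... | a , ma , refl = All.lookup x∉xs ma (h x a (here refl) (there ma) e)

oddBit : Parity → ℕ
oddBit 0ℙ = 0
oddBit 1ℙ = 1

-- ⌈ N ⌉₂ is the least even number ≥ N; it is the value of both domination numbers.
⌈_⌉₂ : ℕ → ℕ
⌈ N ⌉₂ = N + oddBit (parity N)

parity-double : ∀ h → parity (h + h) ≡ 0ℙ
parity-double h = trans (+-homo-+ h h) (self-cancel (parity h))
  where
  self-cancel : ∀ p → p +ℙ p ≡ 0ℙ
  self-cancel 0ℙ = refl
  self-cancel 1ℙ = refl

parity-suc-double : ∀ h → parity (suc (h + h)) ≡ 1ℙ
parity-suc-double h = trans (+-homo-+ 1 (h + h)) (cong (1ℙ +ℙ_) (parity-double h))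

halve : ∀ n → ∃[ h ] (n ≡ h + h ⊎ n ≡ suc (h + h))
halve zero = 0 , inj₁ refl
halve (suc n) with halve n
... | h , inj₁ e = h , inj₂ (cong suc e)
... | h , inj₂ e = suc h , inj₁ (trans (cong suc e) (cong suc (sym (+-suc h h))))

half-< : ∀ r h → r + r < h + h → r < h
half-< r h 2r<2h with r <? h
... | yes r<h = r<h
... | no r≮h = ⊥-elim (<⇒≱ 2r<2h (+-mono-≤ (≮⇒≥ r≮h) (≮⇒≥ r≮h)))

%2≡oddBit : ∀ n → n % 2 ≡ oddBit (parity n)
%2≡oddBit zero = refl
%2≡oddBit (suc zero) = refl
%2≡oddBit (suc (suc n)) = trans (cong (_% 2) (+-comm 2 n)) (trans ([m+n]%n≡m%n n 2) (%2≡oddBit n))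

Odd⇒parity : ∀ n → Odd n → parity n ≡ 1ℙ
Odd⇒parity n odd with parity n | %2≡oddBit n
... | 1ℙ | _ = refl
... | 0ℙ | e with trans (sym e) odd
...   | ()

parity⇒Odd : ∀ n → parity n ≡ 1ℙ → Odd n
parity⇒Odd n e = trans (%2≡oddBit n) (cong oddBit e)

⌈⌉₂-even : ∀ N → parity N ≡ 0ℙ → ⌈ N ⌉₂ ≡ N
⌈⌉₂-even N e rewrite e = +-identityʳ N

⌈⌉₂-odd : ∀ N → parity N ≡ 1ℙ → ⌈ N ⌉₂ ≡ N + 1
⌈⌉₂-odd N e rewrite e = refl

⌈⌉₂-least : ∀ N l → N ≤ l → (l ≡ N → parity l ≡ 0ℙ) → ⌈ N ⌉₂ ≤ l
⌈⌉₂-least N l N≤l tight-even with parity N in eN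
... | 0ℙ = subst (_≤ l) (sym (+-identityʳ N)) N≤l
... | 1ℙ with m≤n⇒m<n∨m≡n N≤l
...   | inj₁ N<l = subst (_≤ l) (+-comm 1 N) N<l
...   | inj₂ refl with trans (sym eN) (tight-even refl)
...     | ()

⌈⌉₂-+ : ∀ M N → (parity M ≡ 1ℙ × parity N ≡ 1ℙ → ⊥) → ⌈ M + N ⌉₂ ≡ ⌈ M ⌉₂ + ⌈ N ⌉₂
⌈⌉₂-+ M N not-both = begin
  M + N + oddBit (parity (M + N))              ≡⟨ cong (λ p → M + N + oddBit p) (+-homo-+ M N) ⟩
  M + N + oddBit (parity M +ℙ parity N)        ≡⟨ cong (M + N +_) (bits (parity M) (parity N) not-both) ⟩
  M + N + (oddBit (parity M) + oddBit (parity N)) ≡⟨ interchange M N _ _ ⟩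
  ⌈ M ⌉₂ + ⌈ N ⌉₂ ∎
  where
  open ≡-Reasoning
  bits : ∀ p q → (p ≡ 1ℙ × q ≡ 1ℙ → ⊥) → oddBit (p +ℙ q) ≡ oddBit p + oddBit q
  bits 0ℙ q _ = refl
  bits 1ℙ 0ℙ _ = refl
  bits 1ℙ 1ℙ not-both = ⊥-elim (not-both (refl , refl))

⌈⌉₂-+-odd : ∀ M N → parity M ≡ 1ℙ → parity N ≡ 1ℙ → ⌈ M + N ⌉₂ ≡ ⌈ M ⌉₂ + ⌈ N ⌉₂ ∸ 2
⌈⌉₂-+-odd M N oM oN rewrite +-homo-+ M N | oM | oN | +-comm M 1 | +-comm N 1 | +-suc M N =
  +-identityʳ (M + N)

-- A finite simple graph: an enumeration of its vertices, an irreflexive symmetric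
-- adjacency, and a Boolean strict total order `before` used to orient its edges.
record FiniteSimple (G : Graph) : Set where
  field
    vertices          : List (V G)
    vertices-unique   : Unique vertices
    vertices-complete : ∀ x → x ∈ vertices
    irreflexive       : ∀ x → T (adj G x x) → ⊥
    symmetric         : ∀ x y → T (adj G x y) → T (adj G y x)
    before            : V G → V G → Bool
    before-flip       : ∀ x y → ¬ x ≡ y → before y x ≡ not (before x y)

record Rows (G : Graph) (k : ℕ) : Set where
  field
    row        : V G → List (V G)
    row-unique : ∀ x → Unique (row x)
    row-adj    : ∀ x y → y ∈ row x → T (adj G x y)
    row-large  : ∀ x → k ≤ length (row x)
    row-back   : ∀ x y → y ∈ row x → suc k ≤ length (row x) ⊎ x ∈ row y

module Inflation (G : Graph) (FS : FiniteSimple G) where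

  open FiniteSimple FS

  GI : Graph
  GI = Inflated G

  VI : Set
  VI = V GI

  _≟I_ : DecidableEquality VI
  _≟I_ = _≟V_ GI

  open Occurrences _≟I_ public

  _=G_ : V G → V G → Bool
  x =G y = ⌊ _≟V_ G x y ⌋

  -- The vertex xy of G_I lies in the clique X_x and corresponds to the arc x → y.
  origin target : VI → V G
  origin u = proj₁ (proj₁ u)
  target u = proj₂ (proj₁ u)

  vertexI : (x y : V G) → T (adj G x y) → VI
  vertexI x y q = ((x , y) , q)

  vertexI-≡ : (u w : VI) → proj₁ u ≡ proj₁ w → u ≡ w
  vertexI-≡ ((x , y) , p) ((.x , .y) , q) refl = cong (vertexI x y) (T-irrelevant p q)

  -- The partner of xy is yx, its unique neighbour outside X_x.
  partner : VI → VI
  partner ((x , y) , q) = vertexI y x (symmetric x y q)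

  partner-involutive : ∀ u → partner (partner u) ≡ u
  partner-involutive u = vertexI-≡ _ _ refl

  inClique : V G → List VI → ℕ
  inClique x S = count (λ u → x =G origin u) S

  private
    ≟I-split : (x y x' y' : V G) (q : T (adj G x y)) (q' : T (adj G x' y')) →
      ⌊ vertexI x y q ≟I vertexI x' y' q' ⌋ ≡ x =G x' ∧ y =G y'
    ≟I-split x y x' y' q q' = by-cases (_≟V_ G x x') (_≟V_ G y y')
      where
      by-cases : (d₁ : Dec (x ≡ x')) (d₂ : Dec (y ≡ y')) →
        ⌊ vertexI x y q ≟I vertexI x' y' q' ⌋ ≡ ⌊ d₁ ⌋ ∧ ⌊ d₂ ⌋
      by-cases (yes refl) (yes refl) = isYes-true (_ ≟I _) (vertexI-≡ _ _ refl)
      by-cases (yes refl) (no ne) = isYes-false (_ ≟I _) (λ e → ne (cong target e))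
      by-cases (no ne) _ = isYes-false (_ ≟I _) (λ e → ne (cong origin e))

    no-loop : (x y : V G) → T (adj G x y) → x =G y ≡ false
    no-loop x y q = isYes-false (_≟V_ G x y) (λ { refl → irreflexive x q })

    -- With a = [x = x'], b = [y = y'], c = [x = y'], d = [y = x'] this says
    -- [xy ~ x'y'] + [xy = x'y'] = [x = x'] + [yx = x'y']; the hypotheses hold
    -- because x'y' and xy are not loops.
    indicator-identity : (a b c d : Bool) → a ∧ c ≡ false → a ∧ d ≡ false →
      ⟦ (a ∧ not b) ∨ (c ∧ d) ⟧ + ⟦ a ∧ b ⟧ ≡ ⟦ a ⟧ + ⟦ d ∧ c ⟧
    indicator-identity true b true d () _
    indicator-identity true b false true _ ()
    indicator-identity true true false false _ _ = refl
    indicator-identity true false false false _ _ = refl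
    indicator-identity false b true true _ _ = refl
    indicator-identity false b true false _ _ = refl
    indicator-identity false b false true _ _ = refl
    indicator-identity false b false false _ _ = refl

  -- The neighbours of v = xy in S are the other S-vertices of X_x and possibly yx:
  --   |N(v) ∩ S| + [v ∈ S] = |S ∩ X_x| + [yx ∈ S].
  neighbour-count : (v : VI) (S : List VI) →
    nbrsIn GI v S + occ v S ≡ inClique (origin v) S + occ (partner v) S
  neighbour-count v@((x , y) , q) S =
    trans (cong (_+ occ v S) (length-filter (adj GI v) S))
      (count-pointwise (adj GI v) (λ u → ⌊ v ≟I u ⌋) (λ u → x =G origin u) (λ u → ⌊ partner v ≟I u ⌋) S pointwise)
    where
    pointwise : ∀ u → u ∈ S →
      ⟦ adj GI v u ⟧ + ⟦ ⌊ v ≟I u ⌋ ⟧ ≡ ⟦ x =G origin u ⟧ + ⟦ ⌊ partner v ≟I u ⌋ ⟧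
    pointwise ((x' , y') , q') _
      rewrite ≟I-split x y x' y' q q' | ≟I-split y x x' y' (symmetric x y q) q' =
      indicator-identity (x =G x') (y =G y') (x =G y') (y =G x') 
        (x'y'-no-loop (_≟V_ G x x')) (xy-no-loop (_≟V_ G x x'))
      where
      x'y'-no-loop : (d : Dec (x ≡ x')) → ⌊ d ⌋ ∧ x =G y' ≡ false
      x'y'-no-loop (yes refl) = no-loop x y' q'
      x'y'-no-loop (no _) = refl
      xy-no-loop : (d : Dec (x ≡ x')) → ⌊ d ⌋ ∧ y =G x' ≡ false
      xy-no-loop (yes refl) = no-loop y x (symmetric x y q)
      xy-no-loop (no _) = refl

  -- A duplicate-free set of vertices of G_I closed under the partner map has even
  -- size: the partner map exchanges the arcs oriented forwards and backwards.
  module _ where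
    private
      forward : VI → Bool
      forward u = before (origin u) (target u)

      backward : VI → Bool
      backward u = not (forward u)

      forward-partner : ∀ u → forward (partner u) ≡ backward u
      forward-partner ((x , y) , q) = before-flip x y (λ { refl → irreflexive x q })

      select : (VI → Bool) → List VI → List VI
      select P S = filter (λ u → Data.Bool.T? (P u)) S

      count-partner-≤ : (P Q : VI → Bool) (S : List VI) → Unique S → (∀ u → u ∈ S → partner u ∈ S) →
        (∀ u → T (P u) → T (Q (partner u))) → count P S ≤ count Q S
      count-partner-≤ P Q S uS closed PQ =
        subst₂ _≤_ (trans (LP.length-map partner (select P S)) (length-filter P S)) (length-filter Q S)
          (unique-⊆-length (map partner (select P S)) (select Q S) (UP.map⁺ partner-injective (UP.filter⁺ _ uS)) image)
        where
        partner-injective : ∀ {a b} → partner a ≡ partner b → a ≡ b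
        partner-injective {a} {b} e = trans (sym (partner-involutive a)) (trans (cong partner e) (partner-involutive b))
        image : ∀ z → z ∈ map partner (select P S) → z ∈ select Q S
        image z m with MP.∈-map⁻ partner m
        ... | w , mw , refl with MP.∈-filter⁻ (λ u → Data.Bool.T? (P u)) {xs = S} mw
        ... | w∈S , Pw = MP.∈-filter⁺ (λ u → Data.Bool.T? (Q u)) (closed w w∈S) (PQ w Pw)

    closed-even : (S : List VI) → Unique S → (∀ u → u ∈ S → partner u ∈ S) → parity (length S) ≡ 0ℙ
    closed-even S uS closed =
      trans (cong parity (trans (count-complement forward S) (cong (count forward S +_) (sym balanced))))
            (parity-double (count forward S))
      where
      fwd→bwd : ∀ u → T (forward u) → T (backward (partner u))
      fwd→bwd u t rewrite forward-partner u with forward u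
      ... | true = tt
      bwd→fwd : ∀ u → T (backward u) → T (forward (partner u))
      bwd→fwd u t rewrite forward-partner u with forward u
      ... | false = tt
      balanced : count forward S ≡ count backward S
      balanced = ≤-antisym (count-partner-≤ forward backward S uS closed fwd→bwd)
                           (count-partner-≤ backward forward S uS closed bwd→fwd)

  module LowerBound (k : ℕ) (2≤k : 2 ≤ k) (neighbour : ∀ x → Σ (V G) (λ y → T (adj G x y)))
                    (S : List VI) (ktds : IsKTDS GI k S) where

    private
      uS : Unique S
      uS = proj₁ ktds

      dominating : ∀ v → k ≤ nbrsIn GI v S
      dominating = proj₂ ktds

    -- A vertex u ∈ S has k neighbours in S, but is not one of them itself.
    member-bound : ∀ u → u ∈ S → suc k ≤ inClique (origin u) S + occ (partner u) S
    member-bound u u∈S = subst (suc k ≤_) (neighbour-count u S)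
      (subst (_≤ nbrsIn GI u S + occ u S) (+-comm k 1) (+-mono-≤ (dominating u) (occ-∈ u S u∈S)))

    occupied-clique : ∀ u → u ∈ S → k ≤ inClique (origin u) S
    occupied-clique u u∈S = ≤-pred (begin
      suc k                                           ≤⟨ member-bound u u∈S ⟩
      inClique (origin u) S + occ (partner u) S       ≤⟨ +-monoʳ-≤ _ (occ-≤1 (partner u) S uS) ⟩
      inClique (origin u) S + 1                       ≡⟨ +-comm _ 1 ⟩
      suc (inClique (origin u) S)                     ∎)
      where open ≤-Reasoning

    -- An empty clique X_x is impossible: a vertex xy would have ≤ 1 neighbour in S.
    empty-clique : ∀ x → inClique x S ≡ 0 → ⊥
    empty-clique x empty = <⇒≱ 2≤k (begin
      k                                   ≤⟨ dominating v ⟩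
      nbrsIn GI v S                       ≤⟨ m≤m+n _ (occ v S) ⟩
      nbrsIn GI v S + occ v S             ≡⟨ neighbour-count v S ⟩
      inClique x S + occ (partner v) S    ≡⟨ cong (_+ occ (partner v) S) empty ⟩
      occ (partner v) S                   ≤⟨ occ-≤1 (partner v) S uS ⟩
      1                                   ∎)
      where
      open ≤-Reasoning
      v : VI
      v = vertexI x (proj₁ (neighbour x)) (proj₂ (neighbour x))

    clique-large : ∀ x → k ≤ inClique x S
    clique-large x with inClique x S in eq
    ... | zero = ⊥-elim (empty-clique x eq)
    ... | suc c with count-witness (λ u → x =G origin u) S (subst (1 ≤_) (sym eq) (s≤s z≤n))
    ...   | u , u∈S , x≡origin rewrite toWitness x≡origin = subst (k ≤_) eq (occupied-clique u u∈S)

    tight-closed : (∀ x → inClique x S ≡ k) → ∀ u → u ∈ S → partner u ∈ S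
    tight-closed tight u u∈S = occ-∈⁻ (partner u) S
      (+-cancelˡ-≤ k 1 _ (subst (_≤ k + occ (partner u) S) (+-comm 1 k)
        (subst (λ c → suc k ≤ c + occ (partner u) S) (tight (origin u)) (member-bound u u∈S))))

    size-by-cliques : length S ≡ sumOver (λ x → inClique x S) vertices
    size-by-cliques = Occurrences.length-by-key (_≟V_ G) origin vertices vertices-unique vertices-complete S

    lower-bound : ⌈ k * length vertices ⌉₂ ≤ length S
    lower-bound = ⌈⌉₂-least _ _ at-least tight-even
      where
      at-least : k * length vertices ≤ length S
      at-least = subst (k * length vertices ≤_) (sym size-by-cliques)
                   (sumOver-lower k _ vertices (λ x _ → clique-large x))
      tight-even : length S ≡ k * length vertices → parity (length S) ≡ 0ℙ
      tight-even e = closed-even S uS (tight-closed (λ x →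
        sumOver-tight k _ vertices (λ x _ → clique-large x) (trans (sym size-by-cliques) e) x (vertices-complete x)))

  module Selection {k : ℕ} (R : Rows G k) where

    open Rows R

    arcs : (x : V G) (ys : List (V G)) → (∀ y → y ∈ ys → T (adj G x y)) → List VI
    arcs x [] _ = []
    arcs x (y ∷ ys) h = vertexI x y (h y (here refl)) ∷ arcs x ys (λ z m → h z (there m))

    length-arcs : ∀ x ys h → length (arcs x ys h) ≡ length ys
    length-arcs x [] h = refl
    length-arcs x (y ∷ ys) h = cong suc (length-arcs x ys _)

    ∈-arcs⁻ : ∀ x ys h u → u ∈ arcs x ys h → origin u ≡ x × target u ∈ ys
    ∈-arcs⁻ x (y ∷ ys) h u (here refl) = refl , here refl
    ∈-arcs⁻ x (y ∷ ys) h u (there m) = let (o , t) = ∈-arcs⁻ x ys _ u m in o , there t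

    ∈-arcs⁺ : ∀ x ys h y (q : T (adj G x y)) → y ∈ ys → vertexI x y q ∈ arcs x ys h
    ∈-arcs⁺ x (z ∷ ys) h y q (here refl) = here (vertexI-≡ _ _ refl)
    ∈-arcs⁺ x (z ∷ ys) h y q (there m) = there (∈-arcs⁺ x ys _ y q m)

    arcs-unique : ∀ x ys h → Unique ys → Unique (arcs x ys h)
    arcs-unique x [] h _ = []
    arcs-unique x (y ∷ ys) h (y∉ys ∷ u) =
      All.tabulate (λ {w} m e → All.lookup y∉ys (proj₂ (∈-arcs⁻ x ys _ w m)) (cong target e))
        ∷ arcs-unique x ys _ u

    block : V G → List VI
    block x = arcs x (row x) (row-adj x)

    blocks : List (V G) → List VI
    blocks [] = []
    blocks (x ∷ xs) = block x ++ blocks xs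

    selection : List VI
    selection = blocks vertices

    count-blocks : (P : VI → Bool) (xs : List (V G)) → count P (blocks xs) ≡ sumOver (λ x → count P (block x)) xs
    count-blocks P [] = refl
    count-blocks P (x ∷ xs) = trans (count-++ P (block x) (blocks xs)) (cong (count P (block x) +_) (count-blocks P xs))

    count-selection : (P : VI → Bool) (x : V G) →
      (∀ x' u → u ∈ block x' → ¬ x' ≡ x → P u ≡ false) → count P selection ≡ count P (block x)
    count-selection P x off = trans (count-blocks P vertices)
      (Occurrences.sumOver-single (_≟V_ G) _ vertices x vertices-unique (vertices-complete x)
        (λ x' ne → count-none P (block x') (λ u m → off x' u m ne)))

    block-origin : ∀ x u → u ∈ block x → origin u ≡ x
    block-origin x u m = proj₁ (∈-arcs⁻ x (row x) (row-adj x) u m)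

    occ-selection : ∀ w → occ w selection ≡ occ w (block (origin w))
    occ-selection w = count-selection _ (origin w) (λ x' u m x'≢x →
      isYes-false (w ≟I u) (λ e → x'≢x (trans (sym (block-origin x' u m)) (cong origin (sym e)))))

    inClique-selection : ∀ x → inClique x selection ≡ length (row x)
    inClique-selection x = begin
      inClique x selection                  ≡⟨ count-selection _ x other-cliques ⟩
      count (λ u → x =G origin u) (block x) ≡⟨ count-ext _ _ (block x) own-clique ⟩
      count (λ _ → true) (block x)          ≡⟨ count-const-true (block x) ⟩
      length (block x)                      ≡⟨ length-arcs x (row x) (row-adj x) ⟩
      length (row x)                        ∎
      where
      open ≡-Reasoning
      other-cliques : ∀ x' u → u ∈ block x' → ¬ x' ≡ x → x =G origin u ≡ false
      other-cliques x' u m x'≢x =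
        isYes-false (_≟V_ G x (origin u)) (λ e → x'≢x (trans (sym (block-origin x' u m)) (sym e)))
      own-clique : ∀ u → u ∈ block x → x =G origin u ≡ true
      own-clique u m = isYes-true (_≟V_ G x (origin u)) (sym (block-origin x u m))

    selection-length : length selection ≡ sumOver (λ x → length (row x)) vertices
    selection-length = trans (sym (count-const-true selection)) (trans (count-blocks _ vertices)
      (sumOver-ext _ _ vertices (λ x _ →
        trans (count-const-true (block x)) (length-arcs x (row x) (row-adj x)))))

    selection-unique : Unique selection
    selection-unique = occ-unique selection (λ w →
      subst (_≤ 1) (sym (occ-selection w)) (occ-≤1 w _ (arcs-unique _ _ _ (row-unique _))))

    balance : ∀ v → k + occ v selection ≤ inClique (origin v) selection + occ (partner v) selection
    balance v@((x , y) , q) with occ v selection in eo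
    ... | zero = subst (_≤ inClique x selection + occ (partner v) selection) (sym (+-identityʳ k))
                   (≤-trans (subst (k ≤_) (sym (inClique-selection x)) (row-large x)) (m≤m+n _ _))
    ... | suc (suc _) = ⊥-elim (too-many (subst (_≤ 1) eo (occ-≤1 v selection selection-unique)))
      where
      too-many : ∀ {n} → suc (suc n) ≤ 1 → ⊥
      too-many (s≤s ())
    ... | suc zero with row-back x y y∈row
      where
      y∈row : y ∈ row x
      y∈row = proj₂ (∈-arcs⁻ x (row x) (row-adj x) v
                (occ-∈⁻ v (block x) (subst (1 ≤_) (trans (sym eo) (occ-selection v)) (s≤s z≤n))))
    ...   | inj₁ long = subst (_≤ inClique x selection + occ (partner v) selection) (+-comm 1 k)
              (≤-trans (subst (suc k ≤_) (sym (inClique-selection x)) long) (m≤m+n _ _))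
    ...   | inj₂ x∈row = +-mono-≤ (subst (k ≤_) (sym (inClique-selection x)) (row-large x))
              (subst (1 ≤_) (sym (occ-selection (partner v)))
                (occ-∈ (partner v) (block y) (∈-arcs⁺ y (row y) (row-adj y) x (symmetric x y q) x∈row)))

    selection-ktds : IsKTDS GI k selection
    selection-ktds = selection-unique , λ v →
      +-cancelʳ-≤ (occ v selection) k _
        (subst (k + occ v selection ≤_) (sym (neighbour-count v selection)) (balance v))

  γ-by-rows : (k : ℕ) → 2 ≤ k → (∀ x → Σ (V G) (λ y → T (adj G x y))) → (R : Rows G k) →
    sumOver (λ x → length (Rows.row R x)) vertices ≡ ⌈ k * length vertices ⌉₂ →
    IsγKT GI k ⌈ k * length vertices ⌉₂
  γ-by-rows k 2≤k neighbour R optimal =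
    (selection , selection-ktds , trans selection-length optimal) ,
    λ S ktds → LowerBound.lower-bound k 2≤k neighbour S ktds
    where open Selection R

≢⇒adjK : ∀ {n} (x y : Fin n) → ¬ x ≡ y → T (adj (K n) x y)
≢⇒adjK x y x≢y rewrite isYes-false (x ≟F y) x≢y = tt

adjK⇒≢ : ∀ {n} (x y : Fin n) → T (adj (K n) x y) → ¬ x ≡ y
adjK⇒≢ x y t refl rewrite isYes-true (x ≟F x) refl = t

_before_ : ∀ {n} → Fin n → Fin n → Bool
x before y = ⌊ toℕ x <? toℕ y ⌋

before-flip : ∀ {n} (x y : Fin n) → ¬ x ≡ y → y before x ≡ not (x before y)
before-flip x y x≢y with <-cmp (toℕ x) (toℕ y)
... | tri< x<y _ y≮x = trans (isYes-false (toℕ y <? toℕ x) y≮x) (cong not (sym (isYes-true (toℕ x <? toℕ y) x<y)))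
... | tri≈ _ x=y _ = ⊥-elim (x≢y (toℕ-injective x=y))
... | tri> x≮y _ y<x = trans (isYes-true (toℕ y <? toℕ x) y<x) (cong not (sym (isYes-false (toℕ x <? toℕ y) x≮y)))

K-simple : ∀ n → FiniteSimple (K n)
K-simple n = record
  { vertices = allFin n
  ; vertices-unique = UP.allFin⁺ n
  ; vertices-complete = MP.∈-allFin
  ; irreflexive = λ x t → adjK⇒≢ x x t refl
  ; symmetric = λ x y t → ≢⇒adjK y x (λ e → adjK⇒≢ x y t (sym e))
  ; before = _before_
  ; before-flip = before-flip
  }

length-allFin : ∀ n → length (allFin n) ≡ n
length-allFin n = LP.length-tabulate (λ i → i)

totalK : ∀ {n k} → Rows (K n) k → ℕ
totalK {n} R = sumOver (λ x → length (Rows.row R x)) (allFin n)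

record Deficient (n k : ℕ) (a : Fin n) : Set where
  field
    nbr           : Fin n → List (Fin n)
    nbr-unique    : ∀ x → Unique (nbr x)
    nbr-irreflexive : ∀ x y → y ∈ nbr x → ¬ x ≡ y
    nbr-symmetric : ∀ x y → y ∈ nbr x → x ∈ nbr y
    nbr-degree    : ∀ x → length (nbr x) + ⟦ ⌊ x ≟F a ⌋ ⟧ ≡ k

K-neighbour : ∀ n (x : Fin (suc (suc n))) → Σ (Fin (suc (suc n))) (λ y → T (adj (K (suc (suc n))) x y))
K-neighbour n fzero = fsuc fzero , tt
K-neighbour n (fsuc x) = fzero , tt

-- Circulants: the vertices of K_n as ℤ_n, with x ⊕ d the vertex d steps after x.

module Circulant (n : ℕ) .{{_ : NonZero n}} where

  infixl 6 _⊕_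
  _⊕_ : Fin n → ℕ → Fin n
  x ⊕ d = fromℕ< (m%n<n (toℕ x + d) n)

  toℕ-⊕ : ∀ x d → toℕ (x ⊕ d) ≡ (toℕ x + d) % n
  toℕ-⊕ x d = toℕ-fromℕ< (m%n<n (toℕ x + d) n)

  %-absorbˡ : ∀ a b → (a % n + b) % n ≡ (a + b) % n
  %-absorbˡ a b = begin
    (a % n + b) % n              ≡⟨ %-distribˡ-+ (a % n) b n ⟩
    (a % n % n + b % n) % n      ≡⟨ cong (λ z → (z + b % n) % n) (m%n%n≡m%n a n) ⟩
    (a % n + b % n) % n          ≡⟨ %-distribˡ-+ a b n ⟨
    (a + b) % n                  ∎
    where open ≡-Reasoning

  ⊕-assoc : ∀ x d e → x ⊕ d ⊕ e ≡ x ⊕ (d + e)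
  ⊕-assoc x d e = toℕ-injective (begin
    toℕ (x ⊕ d ⊕ e)              ≡⟨ toℕ-⊕ (x ⊕ d) e ⟩
    (toℕ (x ⊕ d) + e) % n        ≡⟨ cong (λ z → (z + e) % n) (toℕ-⊕ x d) ⟩
    ((toℕ x + d) % n + e) % n    ≡⟨ %-absorbˡ (toℕ x + d) e ⟩
    (toℕ x + d + e) % n          ≡⟨ cong (_% n) (+-assoc (toℕ x) d e) ⟩
    (toℕ x + (d + e)) % n        ≡⟨ toℕ-⊕ x (d + e) ⟨
    toℕ (x ⊕ (d + e))            ∎)
    where open ≡-Reasoning

  ⊕-comm : ∀ x d e → x ⊕ d ⊕ e ≡ x ⊕ e ⊕ d
  ⊕-comm x d e = trans (⊕-assoc x d e) (trans (cong (x ⊕_) (+-comm d e)) (sym (⊕-assoc x e d)))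

  ⊕-n : ∀ x → x ⊕ n ≡ x
  ⊕-n x = toℕ-injective (trans (toℕ-⊕ x n) (trans ([m+n]%n≡m%n (toℕ x) n) (m<n⇒m%n≡m (toℕ<n x))))

  ⊕-back : ∀ x d → d ≤ n → x ⊕ d ⊕ (n ∸ d) ≡ x
  ⊕-back x d d≤n = trans (⊕-assoc x d (n ∸ d)) (trans (cong (x ⊕_) (m+[n∸m]≡n d≤n)) (⊕-n x))

  -- The offset from x to x ⊕ d can be read off, so ⊕ is injective in the offset.
  offset-of : ∀ x d → d < n → toℕ (x ⊕ d ⊕ (n ∸ toℕ x)) ≡ d
  offset-of x d d<n = begin
    toℕ (x ⊕ d ⊕ (n ∸ toℕ x))    ≡⟨ cong toℕ (⊕-comm x d (n ∸ toℕ x)) ⟩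
    toℕ (x ⊕ (n ∸ toℕ x) ⊕ d)    ≡⟨ cong toℕ (⊕-assoc x (n ∸ toℕ x) d) ⟩
    toℕ (x ⊕ (n ∸ toℕ x + d))    ≡⟨ toℕ-⊕ x _ ⟩
    (toℕ x + (n ∸ toℕ x + d)) % n ≡⟨ cong (_% n) (sym (+-assoc (toℕ x) _ d)) ⟩
    (toℕ x + (n ∸ toℕ x) + d) % n ≡⟨ cong (λ z → (z + d) % n) (m+[n∸m]≡n (<⇒≤ (toℕ<n x))) ⟩
    (n + d) % n                   ≡⟨ cong (_% n) (+-comm n d) ⟩
    (d + n) % n                   ≡⟨ [m+n]%n≡m%n d n ⟩
    d % n                         ≡⟨ m<n⇒m%n≡m d<n ⟩
    d                             ∎
    where open ≡-Reasoning

  ⊕-injective : ∀ x d e → d < n → e < n → x ⊕ d ≡ x ⊕ e → d ≡ e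
  ⊕-injective x d e d<n e<n eq =
    trans (sym (offset-of x d d<n)) (trans (cong (λ y → toℕ (y ⊕ (n ∸ toℕ x))) eq) (offset-of x e e<n))

  ⊕-moves : ∀ x d → 0 < d → d < n → ¬ x ≡ x ⊕ d
  ⊕-moves x d 0<d d<n eq = <⇒≢ 0<d (⊕-injective x 0 d (<-trans 0<d d<n) d<n (trans zero-step eq))
    where
    zero-step : x ⊕ 0 ≡ x
    zero-step = toℕ-injective (trans (toℕ-⊕ x 0) (trans (cong (_% n) (+-identityʳ (toℕ x))) (m<n⇒m%n≡m (toℕ<n x))))

  module Offsets (D : Fin n → List ℕ) (D-unique : ∀ x → Unique (D x))
                 (D-bounded : ∀ x d → d ∈ D x → 0 < d × d < n) where

    shifted : Fin n → List (Fin n)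
    shifted x = map (x ⊕_) (D x)

    shifted-unique : ∀ x → Unique (shifted x)
    shifted-unique x = map-unique (x ⊕_) (D x) (D-unique x)
      (λ d e md me → ⊕-injective x d e (proj₂ (D-bounded x d md)) (proj₂ (D-bounded x e me)))

    length-shifted : ∀ x → length (shifted x) ≡ length (D x)
    length-shifted x = LP.length-map (x ⊕_) (D x)

    shifted-irreflexive : ∀ x y → y ∈ shifted x → ¬ x ≡ y
    shifted-irreflexive x y m with MP.∈-map⁻ (x ⊕_) m
    ... | d , md , refl = ⊕-moves x d (proj₁ (D-bounded x d md)) (proj₂ (D-bounded x d md))

    reciprocal : ∀ x d → d ∈ D x → (n ∸ d) ∈ D (x ⊕ d) → x ∈ shifted (x ⊕ d)
    reciprocal x d md back =
      subst (_∈ shifted (x ⊕ d)) (⊕-back x d (<⇒≤ (proj₂ (D-bounded x d md)))) (MP.∈-map⁺ (x ⊕ d ⊕_) back)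

    offset-rows : (k : ℕ) → (∀ x → k ≤ length (D x)) →
      (∀ x d → d ∈ D x → suc k ≤ length (D x) ⊎ (n ∸ d) ∈ D (x ⊕ d)) → Rows (K n) k
    offset-rows k large back = record
      { row = shifted
      ; row-unique = shifted-unique
      ; row-adj = λ x y m → ≢⇒adjK x y (shifted-irreflexive x y m)
      ; row-large = λ x → subst (k ≤_) (sym (length-shifted x)) (large x)
      ; row-back = row-back
      }
      where
      row-back : ∀ x y → y ∈ shifted x → suc k ≤ length (shifted x) ⊎ x ∈ shifted y
      row-back x y m with MP.∈-map⁻ (x ⊕_) m
      ... | d , md , refl with back x d md
      ...   | inj₁ long = inj₁ (subst (suc k ≤_) (sym (length-shifted x)) long)
      ...   | inj₂ rec = inj₂ (reciprocal x d md rec)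

    total-shifted : sumOver (λ x → length (shifted x)) (allFin n) ≡ sumOver (λ x → length (D x)) (allFin n)
    total-shifted = sumOver-ext _ _ (allFin n) (λ x _ → length-shifted x)

  regular-rows : (k : ℕ) (D : List ℕ) → Unique D → (∀ d → d ∈ D → 0 < d × d < n) →
    (∀ d → d ∈ D → (n ∸ d) ∈ D) → length D ≡ k →
    Σ[ R ∈ Rows (K n) k ] totalK R ≡ k * n
  regular-rows k D D-unique D-bounded D-symmetric D-size =
    offset-rows k (λ _ → ≤-reflexive (sym D-size)) (λ x d m → inj₂ (D-symmetric d m)) ,
    trans total-shifted (trans (sumOver-const k _ (allFin n) (λ _ _ → D-size)) (cong (k *_) (length-allFin n)))
    where open Offsets (λ _ → D) (λ _ → D-unique) (λ _ → D-bounded)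

  band : ℕ → ℕ → List ℕ
  band s r = applyUpTo (s +_) r ++ applyUpTo (λ i → n ∸ (s + i)) r

  length-band : ∀ s r → length (band s r) ≡ r + r
  length-band s r = trans (LP.length-++ (applyUpTo (s +_) r))
    (cong₂ _+_ (LP.length-applyUpTo (s +_) r) (LP.length-applyUpTo (λ i → n ∸ (s + i)) r))

  -- When 2(s + r) ≤ n + 1 the two halves of the band do not clash.
  module Band (s r : ℕ) (1≤s : 1 ≤ s) (fits : (s + r) + (s + r) ≤ suc n) where

    t : ℕ
    t = s + r

    t≤n : t ≤ n
    t≤n = ≤-pred (≤-trans (subst (_≤ t + t) (+-comm t 1) (+-monoʳ-≤ t (≤-trans 1≤s (m≤m+n s r)))) fits)

    in-range : ∀ i → i < r → s ≤ s + i × s + i < t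
    in-range i i<r = m≤m+n s i , +-monoʳ-< s i<r

    ∈-band⁻ : ∀ d → d ∈ band s r → ∃[ e ] (s ≤ e × e < t × (d ≡ e ⊎ d ≡ n ∸ e))
    ∈-band⁻ d m with MP.∈-++⁻ (applyUpTo (s +_) r) m
    ... | inj₁ m₁ = let (i , i<r , d≡) = MP.∈-applyUpTo⁻ (s +_) m₁ in
                    s + i , proj₁ (in-range i i<r) , proj₂ (in-range i i<r) , inj₁ d≡
    ... | inj₂ m₂ = let (i , i<r , d≡) = MP.∈-applyUpTo⁻ (λ i → n ∸ (s + i)) m₂ in
                    s + i , proj₁ (in-range i i<r) , proj₂ (in-range i i<r) , inj₂ d≡

    ∈-band⁺ : ∀ e → s ≤ e → e < t → e ∈ band s r × (n ∸ e) ∈ band s r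
    ∈-band⁺ e s≤e e<t with MP.∈-applyUpTo⁺ (s +_) i<r | MP.∈-applyUpTo⁺ (λ i → n ∸ (s + i)) i<r
      where
      i<r : e ∸ s < r
      i<r = +-cancelˡ-< s (e ∸ s) r (subst (_< t) (sym (m+[n∸m]≡n s≤e)) e<t)
    ... | m₁ | m₂ rewrite m+[n∸m]≡n s≤e = MP.∈-++⁺ˡ m₁ , MP.∈-++⁺ʳ (applyUpTo (s +_) r) m₂

    band-bounded : ∀ d → d ∈ band s r → 0 < d × d < n
    band-bounded d m with ∈-band⁻ d m
    ... | e , s≤e , e<t , inj₁ refl = ≤-trans 1≤s s≤e , ≤-trans e<t t≤n
    ... | e , s≤e , e<t , inj₂ refl =
      m<n⇒0<n∸m (≤-trans e<t t≤n) , ∸-monoʳ-< (≤-trans 1≤s s≤e) (≤-trans (<⇒≤ e<t) t≤n)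

    band-symmetric : ∀ d → d ∈ band s r → (n ∸ d) ∈ band s r
    band-symmetric d m with ∈-band⁻ d m
    ... | e , s≤e , e<t , inj₁ refl = proj₂ (∈-band⁺ e s≤e e<t)
    ... | e , s≤e , e<t , inj₂ refl =
      subst (_∈ band s r) (sym (m∸[m∸n]≡n (≤-trans (<⇒≤ e<t) t≤n))) (proj₁ (∈-band⁺ e s≤e e<t))

    ∉-band : ∀ d → (d < s ⊎ t ≤ d) → (n ∸ d < s ⊎ t ≤ n ∸ d) → d ∉ band s r
    ∉-band d out out' m with ∈-band⁻ d m
    ... | e , s≤e , e<t , inj₁ refl = outside out s≤e e<t
      where
      outside : ∀ {e} → (e < s ⊎ t ≤ e) → s ≤ e → e < t → ⊥
      outside (inj₁ e<s) s≤e _ = <⇒≱ e<s s≤e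
      outside (inj₂ t≤e) _ e<t = <⇒≱ e<t t≤e
    ... | e , s≤e , e<t , inj₂ refl rewrite m∸[m∸n]≡n (≤-trans (<⇒≤ e<t) t≤n) = outside out' s≤e e<t
      where
      outside : ∀ {e} → (e < s ⊎ t ≤ e) → s ≤ e → e < t → ⊥
      outside (inj₁ e<s) s≤e _ = <⇒≱ e<s s≤e
      outside (inj₂ t≤e) _ e<t = <⇒≱ e<t t≤e

    band-unique : Unique (band s r)
    band-unique = UP.++⁺ (UP.applyUpTo⁺₁ (s +_) r (λ i<j _ e → <⇒≢ i<j (+-cancelˡ-≡ s _ _ e)))
      (UP.applyUpTo⁺₁ (λ i → n ∸ (s + i)) r (λ {i} {j} i<j j<r e → <⇒≢ i<j
        (+-cancelˡ-≡ s _ _ (trans (sym (m∸[m∸n]≡n (bound i (<-trans i<j j<r))))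
          (trans (cong (n ∸_) e) (m∸[m∸n]≡n (bound j j<r)))))))
      (λ { (m₁ , m₂) → clash m₁ m₂ })
      where
      bound : ∀ i → i < r → s + i ≤ n
      bound i i<r = ≤-trans (<⇒≤ (proj₂ (in-range i i<r))) t≤n
      clash : ∀ {d} → d ∈ applyUpTo (s +_) r → d ∈ applyUpTo (λ i → n ∸ (s + i)) r → ⊥
      clash m₁ m₂ with MP.∈-applyUpTo⁻ (s +_) m₁ | MP.∈-applyUpTo⁻ (λ i → n ∸ (s + i)) m₂
      ... | i , i<r , refl | j , j<r , e = <⇒≢ short (trans (cong (_+ (s + j)) e) (m∸n+n≡m (bound j j<r)))
        where
        -- (s + i) + (s + j) ≤ 2t − 2 < n
        short : s + i + (s + j) < n
        short = ≤-pred (≤-trans (subst (_≤ t + t) (cong suc (+-suc (s + i) (s + j)))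
                  (+-mono-≤ (proj₂ (in-range i i<r)) (proj₂ (in-range j j<r)))) fits)

even-degree-rows : ∀ n r → .{{_ : NonZero n}} → r + r < n → Σ[ R ∈ Rows (K n) (r + r) ] totalK R ≡ (r + r) * n
even-degree-rows n r 2r<n = regular-rows (r + r) (band 1 r) band-unique band-bounded band-symmetric (length-band 1 r)
  where
  open Circulant n
  open Band 1 r (s≤s z≤n) (s≤s (subst (_≤ n) (sym (+-suc r r)) 2r<n))

odd-degree-rows : ∀ h r → .{{_ : NonZero (h + h)}} → r < h →
  Σ[ R ∈ Rows (K (h + h)) (suc (r + r)) ] totalK R ≡ suc (r + r) * (h + h)
odd-degree-rows h r r<h = regular-rows (suc (r + r)) D D-unique D-bounded D-symmetric D-size
  where
  open Circulant (h + h)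
  open Band 1 r (s≤s z≤n) (s≤s (subst (_≤ h + h) (sym (+-suc r r)) (+-mono-≤ r<h (<⇒≤ r<h))))
  D : List ℕ
  D = band 1 r ++ h ∷ []
  opposite-h : h + h ∸ h ≡ h
  opposite-h = m+n∸n≡m h h
  D-unique : Unique D
  D-unique = UP.++⁺ band-unique (All.[] ∷ [])
    (λ { (m₁ , here refl) → ∉-band h (inj₂ r<h) (inj₂ (subst (t ≤_) (sym opposite-h) r<h)) m₁ })
  D-bounded : ∀ d → d ∈ D → 0 < d × d < h + h
  D-bounded d m with MP.∈-++⁻ (band 1 r) m
  ... | inj₁ m₁ = band-bounded d m₁
  ... | inj₂ (here refl) = 0<h , subst (_< h + h) (+-identityʳ h) (+-monoʳ-< h 0<h)
    where
    0<h : 0 < h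
    0<h = ≤-trans (s≤s z≤n) r<h
  D-symmetric : ∀ d → d ∈ D → (h + h ∸ d) ∈ D
  D-symmetric d m with MP.∈-++⁻ (band 1 r) m
  ... | inj₁ m₁ = MP.∈-++⁺ˡ (band-symmetric d m₁)
  ... | inj₂ (here refl) = MP.∈-++⁺ʳ (band 1 r) (here opposite-h)
  D-size : length D ≡ suc (r + r)
  D-size = trans (LP.length-++ (band 1 r)) (trans (cong (_+ 1) (length-band 1 r)) (+-comm (r + r) 1))

-- k = 2r + 1 and n = 2h + 1 both odd, with a distinguished vertex a: offsets
-- ±2, …, ±(r + 1) together with a matching by offsets ±1 of all vertices but a.
-- After relabelling the cycle so that a sits at position 2h, the positions 2i
-- and 2i + 1 are matched (offset +1 from even, −1 = 2h from odd positions).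
module OddOddCirculant (h r : ℕ) (r<h : r < h) (a : Fin (suc (h + h))) where

  n k : ℕ
  n = suc (h + h)
  k = suc (r + r)

  open Circulant n

  open Band 2 r (s≤s z≤n) (s≤s (s≤s (subst (_≤ h + h) (sym (+-suc r (suc r))) (+-mono-≤ r<h r<h))))

  pos : Fin n → ℕ
  pos x = toℕ (x ⊕ (n ∸ suc (toℕ a)))

  pos-⊕ : ∀ x d → pos (x ⊕ d) ≡ (pos x + d) % n
  pos-⊕ x d = trans (cong toℕ (⊕-comm x d _)) (toℕ-⊕ (x ⊕ _) d)

  pos-a : pos a ≡ h + h
  pos-a = trans (toℕ-⊕ a _) (trans (cong (_% n) a+shift) (m<n⇒m%n≡m {n = n} (s≤s ≤-refl)))
    where
    a+shift : toℕ a + (n ∸ suc (toℕ a)) ≡ h + h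
    a+shift = cong pred (m+[n∸m]≡n {suc (toℕ a)} {n} (toℕ<n a))

  pos-last : ∀ x → pos x ≡ h + h → x ≡ a
  pos-last x e = begin
    x                        ≡⟨ ⊕-back x shift shift≤n ⟨
    x ⊕ shift ⊕ (n ∸ shift)  ≡⟨ cong (λ z → z ⊕ (n ∸ shift)) (toℕ-injective (trans e (sym pos-a))) ⟩
    a ⊕ shift ⊕ (n ∸ shift)  ≡⟨ ⊕-back a shift shift≤n ⟩
    a                        ∎
    where
    open ≡-Reasoning
    shift : ℕ
    shift = n ∸ suc (toℕ a)
    shift≤n : shift ≤ n
    shift≤n = m∸n≤m n (suc (toℕ a))

  matchOffset : Parity → ℕ
  matchOffset 0ℙ = 1
  matchOffset 1ℙ = h + h

  pos<n : ∀ x → pos x < n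
  pos<n x = toℕ<n (x ⊕ (n ∸ suc (toℕ a)))

  match-from-odd : ∀ x → parity (pos x) ≡ 1ℙ → pos (x ⊕ (h + h)) < h + h × parity (pos (x ⊕ (h + h))) ≡ 0ℙ
  match-from-odd x odd = from (pos x) refl odd (pos<n x)
    where
    from : ∀ q → pos x ≡ q → parity q ≡ 1ℙ → q < n → pos (x ⊕ (h + h)) < h + h × parity (pos (x ⊕ (h + h))) ≡ 0ℙ
    from (suc q) eq odd (s≤s q<2h) = subst (_< h + h) (sym lands) q<2h , subst (λ z → parity z ≡ 0ℙ) (sym lands) even
      where
      lands : pos (x ⊕ (h + h)) ≡ q
      lands = begin
        pos (x ⊕ (h + h))        ≡⟨ pos-⊕ x (h + h) ⟩
        (pos x + (h + h)) % n    ≡⟨ cong (λ z → (z + (h + h)) % n) eq ⟩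
        (suc q + (h + h)) % n    ≡⟨ cong (_% n) (sym (+-suc q (h + h))) ⟩
        (q + n) % n              ≡⟨ [m+n]%n≡m%n q n ⟩
        q % n                    ≡⟨ m<n⇒m%n≡m (≤-trans q<2h (n≤1+n (h + h))) ⟩
        q                        ∎
        where open ≡-Reasoning
      even : parity q ≡ 0ℙ
      even with parity q in eq'
      ... | 0ℙ = refl
      ... | 1ℙ with trans (sym (trans (+-homo-+ 1 q) (cong (1ℙ +ℙ_) eq'))) odd
      ...   | ()

  match-from-even : ∀ x → ¬ x ≡ a → parity (pos x) ≡ 0ℙ → parity (pos (x ⊕ 1)) ≡ 1ℙ
  match-from-even x x≢a even = begin
    parity (pos (x ⊕ 1))     ≡⟨ cong parity (pos-⊕ x 1) ⟩
    parity ((pos x + 1) % n) ≡⟨ cong (λ z → parity (z % n)) (+-comm (pos x) 1) ⟩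
    parity (suc (pos x) % n) ≡⟨ cong parity (m<n⇒m%n≡m (s≤s below-last)) ⟩
    parity (suc (pos x))     ≡⟨ +-homo-+ 1 (pos x) ⟩
    1ℙ +ℙ parity (pos x)     ≡⟨ cong (1ℙ +ℙ_) even ⟩
    1ℙ                       ∎
    where
    open ≡-Reasoning
    below-last : pos x < h + h
    below-last = ≤∧≢⇒< (≤-pred (pos<n x)) (λ e → x≢a (pos-last x e))

  match-back : ∀ x → ¬ x ≡ a →
    ¬ x ⊕ matchOffset (parity (pos x)) ≡ a ×
    n ∸ matchOffset (parity (pos x)) ≡ matchOffset (parity (pos (x ⊕ matchOffset (parity (pos x)))))
  match-back x x≢a with parity (pos x) in p
  ... | 1ℙ = (λ e → <⇒≢ (proj₁ step) (trans (cong pos e) pos-a)) ,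
             trans (m+n∸n≡m 1 (h + h)) (cong matchOffset (sym (proj₂ step)))
    where
    step : pos (x ⊕ (h + h)) < h + h × parity (pos (x ⊕ (h + h))) ≡ 0ℙ
    step = match-from-odd x p
  ... | 0ℙ = (λ e → parity-clash (trans (sym step) (trans (cong (λ z → parity (pos z)) e) parity-a))) ,
             cong matchOffset (sym step)
    where
    step : parity (pos (x ⊕ 1)) ≡ 1ℙ
    step = match-from-even x x≢a p
    parity-a : parity (pos a) ≡ 0ℙ
    parity-a = trans (cong parity pos-a) (parity-double h)
    parity-clash : 1ℙ ≡ 0ℙ → ⊥
    parity-clash ()

  -- The offsets: the band, plus `extra b p` at a vertex with b = [x = a] whose
  -- position has parity p; away from a the extra offset is the matching.
  module WithExtra (extra : Bool → Parity → List ℕ)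
                   (extra-matching : ∀ p → extra false p ≡ matchOffset p ∷ [])
                   (extra-values : ∀ b p d → d ∈ extra b p → d ≡ 1 ⊎ d ≡ h + h)
                   (extra-unique : ∀ b p → Unique (extra b p)) where

    D : Fin n → List ℕ
    D x = band 2 r ++ extra ⌊ x ≟F a ⌋ (parity (pos x))

    private
      0<2h : 0 < h + h
      0<2h = ≤-trans (s≤s z≤n) (+-mono-≤ (≤-trans (s≤s z≤n) r<h) z≤n)

      t≤2h : t ≤ h + h
      t≤2h = ≤-trans (s≤s r<h) (+-monoˡ-≤ h (≤-trans (s≤s z≤n) r<h))

    D-unique : ∀ x → Unique (D x)
    D-unique x = UP.++⁺ band-unique (extra-unique _ _) (λ { (m₁ , m₂) → outside-band _ (extra-values _ _ _ m₂) m₁ })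
      where
      outside-band : ∀ d → d ≡ 1 ⊎ d ≡ h + h → d ∉ band 2 r
      outside-band _ (inj₁ refl) = ∉-band 1 (inj₁ ≤-refl) (inj₂ t≤2h)
      outside-band _ (inj₂ refl) = ∉-band (h + h) (inj₂ t≤2h) (inj₁ (≤-reflexive (cong suc (m+n∸n≡m 1 (h + h)))))

    D-bounded : ∀ x d → d ∈ D x → 0 < d × d < n
    D-bounded x d m with MP.∈-++⁻ (band 2 r) m
    ... | inj₁ m₁ = band-bounded d m₁
    ... | inj₂ m₂ with extra-values _ _ d m₂
    ...   | inj₁ refl = s≤s z≤n , s≤s 0<2h
    ...   | inj₂ refl = 0<2h , ≤-refl

    open Offsets D D-unique D-bounded public

    offset-back : ∀ x d → d ∈ D x → (x ≡ a × d ∈ extra true (parity (pos a))) ⊎ (n ∸ d) ∈ D (x ⊕ d)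
    offset-back x d m with MP.∈-++⁻ (band 2 r) m
    ... | inj₁ m₁ = inj₂ (MP.∈-++⁺ˡ (band-symmetric d m₁))
    ... | inj₂ m₂ with x ≟F a
    ...   | yes refl = inj₁ (refl , m₂)
    ...   | no x≢a rewrite extra-matching (parity (pos x)) with m₂
    ...     | here refl = inj₂ (MP.∈-++⁺ʳ (band 2 r) reciprocated)
      where
      y : Fin n
      y = x ⊕ matchOffset (parity (pos x))
      reciprocated : n ∸ matchOffset (parity (pos x)) ∈ extra ⌊ y ≟F a ⌋ (parity (pos y))
      reciprocated rewrite isYes-false (y ≟F a) (proj₁ (match-back x x≢a)) | extra-matching (parity (pos y)) =
        here (proj₂ (match-back x x≢a))

    length-D : ∀ x → length (D x) ≡ r + r + length (extra ⌊ x ≟F a ⌋ (parity (pos x)))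
    length-D x = trans (LP.length-++ (band 2 r)) (cong (_+ length (extra ⌊ x ≟F a ⌋ (parity (pos x)))) (length-band 2 r))

  private
    1<2h : 1 < h + h
    1<2h = +-mono-≤ (≤-trans (s≤s z≤n) r<h) (≤-trans (s≤s z≤n) r<h)

  missing-at-a : Bool → Parity → List ℕ
  missing-at-a true _ = []
  missing-at-a false p = matchOffset p ∷ []

  deficient : Deficient n k a
  deficient = record
    { nbr = shifted
    ; nbr-unique = shifted-unique
    ; nbr-irreflexive = shifted-irreflexive
    ; nbr-symmetric = symmetric
    ; nbr-degree = degree
    }
    where
    values : ∀ b p d → d ∈ missing-at-a b p → d ≡ 1 ⊎ d ≡ h + h
    values false 0ℙ d (here refl) = inj₁ refl
    values false 1ℙ d (here refl) = inj₂ refl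
    unique : ∀ b p → Unique (missing-at-a b p)
    unique true p = []
    unique false p = All.[] ∷ []
    open WithExtra missing-at-a (λ _ → refl) values unique
    symmetric : ∀ x y → y ∈ shifted x → x ∈ shifted y
    symmetric x y m with MP.∈-map⁻ (x ⊕_) m
    ... | d , md , refl with offset-back x d md
    ...   | inj₁ (refl , ())
    ...   | inj₂ rec = reciprocal x d md rec
    extra-degree : ∀ b p → length (missing-at-a b p) + ⟦ b ⟧ ≡ 1
    extra-degree true p = refl
    extra-degree false p = refl
    degree : ∀ x → length (shifted x) + ⟦ ⌊ x ≟F a ⌋ ⟧ ≡ k
    degree x = begin
      length (shifted x) + ⟦ b ⟧                  ≡⟨ cong (_+ ⟦ b ⟧) (trans (length-shifted x) (length-D x)) ⟩
      r + r + length (missing-at-a b p) + ⟦ b ⟧   ≡⟨ +-assoc (r + r) _ _ ⟩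
      r + r + (length (missing-at-a b p) + ⟦ b ⟧) ≡⟨ cong (r + r +_) (extra-degree b p) ⟩
      r + r + 1                                   ≡⟨ +-comm (r + r) 1 ⟩
      k                                           ∎
      where
      open ≡-Reasoning
      b : Bool
      b = ⌊ x ≟F a ⌋
      p : Parity
      p = parity (pos x)

  -- Both offsets ±1 at a: a has degree k + 1, so its arcs need no reciprocation.
  both-at-a : Bool → Parity → List ℕ
  both-at-a true _ = 1 ∷ h + h ∷ []
  both-at-a false p = matchOffset p ∷ []

  surplus-rows : Σ[ R ∈ Rows (K n) k ] totalK R ≡ k * n + 1
  surplus-rows = offset-rows k large back , total
    where
    values : ∀ b p d → d ∈ both-at-a b p → d ≡ 1 ⊎ d ≡ h + h
    values true p d (here refl) = inj₁ refl
    values true p d (there (here refl)) = inj₂ refl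
    values false 0ℙ d (here refl) = inj₁ refl
    values false 1ℙ d (here refl) = inj₂ refl
    unique : ∀ b p → Unique (both-at-a b p)
    unique true p = (<⇒≢ 1<2h All.∷ All.[]) ∷ All.[] ∷ []
    unique false p = All.[] ∷ []
    open WithExtra both-at-a (λ _ → refl) values unique
    extra-length : ∀ b p → length (both-at-a b p) ≡ 1 + ⟦ b ⟧
    extra-length true p = refl
    extra-length false p = refl
    degree : ∀ x → length (D x) ≡ k + ⟦ ⌊ x ≟F a ⌋ ⟧
    degree x = trans (length-D x) (trans (cong (r + r +_) (extra-length ⌊ x ≟F a ⌋ (parity (pos x)))) (+-suc (r + r) _))
    large : ∀ x → k ≤ length (D x)
    large x = subst (k ≤_) (sym (degree x)) (m≤m+n k _)
    back : ∀ x d → d ∈ D x → suc k ≤ length (D x) ⊎ (n ∸ d) ∈ D (x ⊕ d)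
    back x d m with offset-back x d m
    ... | inj₁ (refl , _) = inj₁ (≤-reflexive (sym (trans (degree a)
                              (trans (cong (λ b → k + ⟦ b ⟧) (isYes-true (a ≟F a) refl)) (+-comm k 1)))))
    ... | inj₂ rec = inj₂ rec
    total : sumOver (λ x → length (shifted x)) (allFin n) ≡ k * n + 1
    total = begin
      sumOver (λ x → length (shifted x)) (allFin n)                    ≡⟨ total-shifted ⟩
      sumOver (λ x → length (D x)) (allFin n)                          ≡⟨ sumOver-ext _ _ (allFin n) (λ x _ → degree x) ⟩
      sumOver (λ x → k + ⟦ ⌊ x ≟F a ⌋ ⟧) (allFin n)                    ≡⟨ sumOver-+ (λ _ → k) _ (allFin n) ⟩
      sumOver (λ _ → k) (allFin n) + sumOver (λ x → ⟦ ⌊ x ≟F a ⌋ ⟧) (allFin n)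
        ≡⟨ cong₂ _+_ (trans (sumOver-const k _ (allFin n) (λ _ _ → refl)) (cong (k *_) (length-allFin n))) only-a ⟩
      k * n + 1                                                        ∎
      where
      open ≡-Reasoning
      only-a : sumOver (λ x → ⟦ ⌊ x ≟F a ⌋ ⟧) (allFin n) ≡ 1
      only-a = trans (Occurrences.sumOver-single _≟F_ _ (allFin n) a (UP.allFin⁺ n) (MP.∈-allFin a)
                        (λ x x≢a → cong ⟦_⟧ (isYes-false (x ≟F a) x≢a)))
                     (cong ⟦_⟧ (isYes-true (a ≟F a) refl))

-- Split by the parities of k and n: k even, k odd with n even (both regular, k n
-- even), or both odd (one vertex of degree k + 1, total k n + 1).
complete-rows : ∀ n k → k < n → Σ[ R ∈ Rows (K n) k ] totalK R ≡ ⌈ k * n ⌉₂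
complete-rows n k k<n with halve k | halve n
... | r , inj₁ refl | _ =
  let (R , size) = even-degree-rows n r {{>-nonZero (≤-trans (s≤s z≤n) k<n)}} k<n in
  R , trans size (sym (⌈⌉₂-even (k * n) (trans (*-homo-* (r + r) n) (cong (_*ℙ parity n) (parity-double r)))))
... | r , inj₂ refl | h , inj₁ refl =
  let (R , size) = odd-degree-rows h r {{>-nonZero (≤-trans (s≤s z≤n) k<n)}} (half-< r h (<-trans (n<1+n _) k<n)) in
  R , trans size (sym (⌈⌉₂-even (k * n) (trans (*-homo-* k n) (cong₂ _*ℙ_ (parity-suc-double r) (parity-double h)))))
... | r , inj₂ refl | h , inj₂ refl =
  let (R , size) = OddOddCirculant.surplus-rows h r (half-< r h (≤-pred k<n)) fzero in
  R , trans size (sym (⌈⌉₂-odd (k * n) (trans (*-homo-* k n) (cong₂ _*ℙ_ (parity-suc-double r) (parity-suc-double h)))))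

deficient-rows : ∀ n k → k < n → parity k ≡ 1ℙ → parity n ≡ 1ℙ → (a : Fin n) → Deficient n k a
deficient-rows n k k<n odd-k odd-n a with halve k | halve n
... | r , inj₁ refl | _ with trans (sym (parity-double r)) odd-k
...   | ()
deficient-rows n k k<n odd-k odd-n a | r , inj₂ refl | h , inj₁ refl with trans (sym (parity-double h)) odd-n
...   | ()
deficient-rows n k k<n odd-k odd-n a | r , inj₂ refl | h , inj₂ refl =
  OddOddCirculant.deficient h r (half-< r h (≤-pred k<n)) a

γ-complete : ∀ n k → 2 ≤ k → k < n → IsγKT (Inflated (K n)) k ⌈ k * n ⌉₂
γ-complete n@(suc (suc n')) k 2≤k k<n with complete-rows n k k<n
... | R , optimal =
  subst (λ N → IsγKT (Inflated (K n)) k ⌈ k * N ⌉₂) (length-allFin n)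
    (Inflation.γ-by-rows (K n) (K-simple n) k 2≤k (K-neighbour n') R
      (trans optimal (cong (λ N → ⌈ k * N ⌉₂) (sym (length-allFin n)))))
γ-complete (suc zero) (suc (suc k)) 2≤k (s≤s ())

tip : {B : Set} → Bool → B → List B
tip true z = z ∷ []
tip false _ = []

∈-tip : {B : Set} (c : Bool) (z y : B) → y ∈ tip c z → T c × y ≡ z
∈-tip true z y (here e) = tt , e

∈-tip⁺ : {B : Set} (c : Bool) (z : B) → T c → z ∈ tip c z
∈-tip⁺ true z _ = here refl

∧-split : ∀ x y → T (x ∧ y) → T x × T y
∧-split true true _ = tt , tt

∧-intro : ∀ x y → T x → T y → T (x ∧ y)
∧-intro true true _ _ = tt

length-tip : {B : Set} (c : Bool) (z : B) → length (tip c z) ≡ ⟦ c ⟧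
length-tip true z = refl
length-tip false z = refl

tip-unique : {B : Set} (c : Bool) (z : B) → Unique (tip c z)
tip-unique true z = All.[] ∷ []
tip-unique false z = []

inj₁-injective : ∀ {A B : Set} {x y : A} → inj₁ {B = B} x ≡ inj₁ y → x ≡ y
inj₁-injective refl = refl

inj₂-injective : ∀ {A B : Set} {x y : B} → inj₂ {A = A} x ≡ inj₂ y → x ≡ y
inj₂-injective refl = refl

module BridgeGraph (n m : ℕ) (a : Fin n) (b : Fin m) where

  F : Graph
  F = Bridge n m a b

  VF : Set
  VF = Fin n ⊎ Fin m

  vertices : List VF
  vertices = map inj₁ (allFin n) ++ map inj₂ (allFin m)

  length-vertices : length vertices ≡ n + m
  length-vertices = trans (LP.length-++ (map inj₁ (allFin n)))
    (cong₂ _+_ (trans (LP.length-map inj₁ (allFin n)) (length-allFin n))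
               (trans (LP.length-map inj₂ (allFin m)) (length-allFin m)))

  sumOver-vertices : (f : VF → ℕ) →
    sumOver f vertices ≡ sumOver (λ i → f (inj₁ i)) (allFin n) + sumOver (λ j → f (inj₂ j)) (allFin m)
  sumOver-vertices f = trans (sumOver-++ f (map inj₁ (allFin n)) (map inj₂ (allFin m)))
    (cong₂ _+_ (sumOver-map f inj₁ (allFin n)) (sumOver-map f inj₂ (allFin m)))

  _before-F_ : VF → VF → Bool
  inj₁ i before-F inj₁ j = i before j
  inj₂ i before-F inj₂ j = i before j
  inj₁ _ before-F inj₂ _ = true
  inj₂ _ before-F inj₁ _ = false

  F-simple : FiniteSimple F
  F-simple = record
    { vertices = vertices
    ; vertices-unique = UP.++⁺ (UP.map⁺ inj₁-injective (UP.allFin⁺ n)) (UP.map⁺ inj₂-injective (UP.allFin⁺ m))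
                          (λ { (m₁ , m₂) → sides-disjoint m₁ m₂ })
    ; vertices-complete = λ { (inj₁ i) → MP.∈-++⁺ˡ (MP.∈-map⁺ inj₁ (MP.∈-allFin i))
                            ; (inj₂ j) → MP.∈-++⁺ʳ (map inj₁ (allFin n)) (MP.∈-map⁺ inj₂ (MP.∈-allFin j)) }
    ; irreflexive = λ { (inj₁ i) t → adjK⇒≢ i i t refl ; (inj₂ j) t → adjK⇒≢ j j t refl }
    ; symmetric = symmetric
    ; before = _before-F_
    ; before-flip = flip
    }
    where
    sides-disjoint : ∀ {v} → v ∈ map inj₁ (allFin n) → v ∈ map inj₂ (allFin m) → ⊥
    sides-disjoint m₁ m₂ with MP.∈-map⁻ inj₁ m₁ | MP.∈-map⁻ inj₂ m₂
    ... | _ , _ , refl | _ , _ , ()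
    symmetric : ∀ x y → T (adj F x y) → T (adj F y x)
    symmetric (inj₁ i) (inj₁ j) t = FiniteSimple.symmetric (K-simple n) i j t
    symmetric (inj₂ i) (inj₂ j) t = FiniteSimple.symmetric (K-simple m) i j t
    symmetric (inj₁ i) (inj₂ j) t = t
    symmetric (inj₂ j) (inj₁ i) t = t
    flip : ∀ x y → ¬ x ≡ y → y before-F x ≡ not (x before-F y)
    flip (inj₁ i) (inj₁ j) x≢y = before-flip i j (λ e → x≢y (cong inj₁ e))
    flip (inj₂ i) (inj₂ j) x≢y = before-flip i j (λ e → x≢y (cong inj₂ e))
    flip (inj₁ i) (inj₂ j) _ = refl
    flip (inj₂ i) (inj₁ j) _ = refl

  cut-edge : T (adj F (inj₁ a) (inj₂ b))
  cut-edge rewrite isYes-true (a ≟F a) refl | isYes-true (b ≟F b) refl = tt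

  module Glue (L₁ : Fin n → List (Fin n)) (L₂ : Fin m → List (Fin m)) (join : Bool)
              (L₁-unique : ∀ i → Unique (L₁ i)) (L₁-irreflexive : ∀ i j → j ∈ L₁ i → ¬ i ≡ j)
              (L₂-unique : ∀ i → Unique (L₂ i)) (L₂-irreflexive : ∀ i j → j ∈ L₂ i → ¬ i ≡ j) where

    glued : VF → List VF
    glued (inj₁ i) = map inj₁ (L₁ i) ++ tip (join ∧ ⌊ i ≟F a ⌋) (inj₂ b)
    glued (inj₂ j) = map inj₂ (L₂ j) ++ tip (join ∧ ⌊ j ≟F b ⌋) (inj₁ a)

    glued-unique : ∀ x → Unique (glued x)
    glued-unique (inj₁ i) = UP.++⁺ (UP.map⁺ inj₁-injective (L₁-unique i)) (tip-unique _ _)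
      (λ { (m₁ , m₂) → side-clash m₁ m₂ })
      where
      side-clash : ∀ {v} → v ∈ map inj₁ (L₁ i) → v ∈ tip (join ∧ ⌊ i ≟F a ⌋) (inj₂ b) → ⊥
      side-clash m₁ m₂ with MP.∈-map⁻ inj₁ m₁ | ∈-tip _ _ _ m₂
      ... | _ , _ , refl | _ , ()
    glued-unique (inj₂ j) = UP.++⁺ (UP.map⁺ inj₂-injective (L₂-unique j)) (tip-unique _ _)
      (λ { (m₁ , m₂) → side-clash m₁ m₂ })
      where
      side-clash : ∀ {v} → v ∈ map inj₂ (L₂ j) → v ∈ tip (join ∧ ⌊ j ≟F b ⌋) (inj₁ a) → ⊥
      side-clash m₁ m₂ with MP.∈-map⁻ inj₂ m₁ | ∈-tip _ _ _ m₂
      ... | _ , _ , refl | _ , ()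

    data GluedMember : VF → VF → Set where
      clique₁ : ∀ {i j} → j ∈ L₁ i → GluedMember (inj₁ i) (inj₁ j)
      clique₂ : ∀ {i j} → j ∈ L₂ i → GluedMember (inj₂ i) (inj₂ j)
      cut₁    : T join → GluedMember (inj₁ a) (inj₂ b)
      cut₂    : T join → GluedMember (inj₂ b) (inj₁ a)

    ∈-glued⁻ : ∀ x y → y ∈ glued x → GluedMember x y
    ∈-glued⁻ (inj₁ i) y m with MP.∈-++⁻ (map inj₁ (L₁ i)) m
    ... | inj₁ m₁ with MP.∈-map⁻ inj₁ m₁
    ...   | j , mj , refl = clique₁ mj
    ∈-glued⁻ (inj₁ i) y m | inj₂ m₂ with ∈-tip (join ∧ ⌊ i ≟F a ⌋) _ _ m₂
    ...   | t , refl with ∧-split join ⌊ i ≟F a ⌋ t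
    ...     | t-join , t-a with toWitness t-a
    ...       | refl = cut₁ t-join
    ∈-glued⁻ (inj₂ j) y m with MP.∈-++⁻ (map inj₂ (L₂ j)) m
    ... | inj₁ m₁ with MP.∈-map⁻ inj₂ m₁
    ...   | i , mi , refl = clique₂ mi
    ∈-glued⁻ (inj₂ j) y m | inj₂ m₂ with ∈-tip (join ∧ ⌊ j ≟F b ⌋) _ _ m₂
    ...   | t , refl with ∧-split join ⌊ j ≟F b ⌋ t
    ...     | t-join , t-b with toWitness t-b
    ...       | refl = cut₂ t-join

    ∈-glued₁ : ∀ i j → j ∈ L₁ i → inj₁ j ∈ glued (inj₁ i)
    ∈-glued₁ i j m = MP.∈-++⁺ˡ (MP.∈-map⁺ inj₁ m)

    ∈-glued₂ : ∀ i j → j ∈ L₂ i → inj₂ j ∈ glued (inj₂ i)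
    ∈-glued₂ i j m = MP.∈-++⁺ˡ (MP.∈-map⁺ inj₂ m)

    ∈-glued-cut₁ : T join → inj₂ b ∈ glued (inj₁ a)
    ∈-glued-cut₁ t = MP.∈-++⁺ʳ (map inj₁ (L₁ a)) (∈-tip⁺ _ (inj₂ b) (∧-intro join _ t (fromWitness refl)))

    ∈-glued-cut₂ : T join → inj₁ a ∈ glued (inj₂ b)
    ∈-glued-cut₂ t = MP.∈-++⁺ʳ (map inj₂ (L₂ b)) (∈-tip⁺ _ (inj₁ a) (∧-intro join _ t (fromWitness refl)))

    glued-adj : ∀ x y → y ∈ glued x → T (adj F x y)
    glued-adj x y m with ∈-glued⁻ x y m
    ... | clique₁ {i} {j} mj = ≢⇒adjK i j (L₁-irreflexive i j mj)
    ... | clique₂ {i} {j} mj = ≢⇒adjK i j (L₂-irreflexive i j mj)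
    ... | cut₁ _ = cut-edge
    ... | cut₂ _ = cut-edge

    length-glued₁ : ∀ i → length (glued (inj₁ i)) ≡ length (L₁ i) + ⟦ join ∧ ⌊ i ≟F a ⌋ ⟧
    length-glued₁ i = trans (LP.length-++ (map inj₁ (L₁ i))) (cong₂ _+_ (LP.length-map inj₁ (L₁ i)) (length-tip _ _))

    length-glued₂ : ∀ j → length (glued (inj₂ j)) ≡ length (L₂ j) + ⟦ join ∧ ⌊ j ≟F b ⌋ ⟧
    length-glued₂ j = trans (LP.length-++ (map inj₂ (L₂ j))) (cong₂ _+_ (LP.length-map inj₂ (L₂ j)) (length-tip _ _))

    total-glued : sumOver (λ x → length (glued x)) vertices ≡
      sumOver (λ i → length (L₁ i) + ⟦ join ∧ ⌊ i ≟F a ⌋ ⟧) (allFin n) +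
      sumOver (λ j → length (L₂ j) + ⟦ join ∧ ⌊ j ≟F b ⌋ ⟧) (allFin m)
    total-glued = trans (sumOver-vertices _)
      (cong₂ _+_ (sumOver-ext _ _ (allFin n) (λ i _ → length-glued₁ i)) (sumOver-ext _ _ (allFin m) (λ j _ → length-glued₂ j)))

  separate-rows : ∀ {k} (R₁ : Rows (K n) k) (R₂ : Rows (K m) k) →
    Σ[ R ∈ Rows F k ] sumOver (λ x → length (Rows.row R x)) vertices ≡ totalK R₁ + totalK R₂
  separate-rows {k} R₁ R₂ = record
    { row = glued
    ; row-unique = glued-unique
    ; row-adj = glued-adj
    ; row-large = large
    ; row-back = back
    } , trans total-glued (cong₂ _+_ (sumOver-ext _ _ (allFin n) (λ i _ → +-identityʳ _))
                                     (sumOver-ext _ _ (allFin m) (λ j _ → +-identityʳ _)))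
    where
    module R₁ = Rows R₁
    module R₂ = Rows R₂
    open Glue R₁.row R₂.row false R₁.row-unique (λ i j m → adjK⇒≢ i j (R₁.row-adj i j m))
                                  R₂.row-unique (λ i j m → adjK⇒≢ i j (R₂.row-adj i j m))
    large : ∀ x → k ≤ length (glued x)
    large (inj₁ i) = subst (k ≤_) (sym (trans (length-glued₁ i) (+-identityʳ _))) (R₁.row-large i)
    large (inj₂ j) = subst (k ≤_) (sym (trans (length-glued₂ j) (+-identityʳ _))) (R₂.row-large j)
    back : ∀ x y → y ∈ glued x → suc k ≤ length (glued x) ⊎ x ∈ glued y
    back x y m with ∈-glued⁻ x y m
    ... | clique₁ {i} {j} mj with R₁.row-back i j mj
    ...   | inj₁ long = inj₁ (subst (suc k ≤_) (sym (trans (length-glued₁ i) (+-identityʳ _))) long)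
    ...   | inj₂ rec = inj₂ (∈-glued₁ j i rec)
    back x y m | clique₂ {i} {j} mj with R₂.row-back i j mj
    ...   | inj₁ long = inj₁ (subst (suc k ≤_) (sym (trans (length-glued₂ i) (+-identityʳ _))) long)
    ...   | inj₂ rec = inj₂ (∈-glued₂ j i rec)

  -- Two deficient systems joined through the cut-edge: a k-regular graph on F.
  joined-rows : ∀ {k} → Deficient n k a → Deficient m k b →
    Σ[ R ∈ Rows F k ] sumOver (λ x → length (Rows.row R x)) vertices ≡ k * (n + m)
  joined-rows {k} D₁ D₂ = record
    { row = glued
    ; row-unique = glued-unique
    ; row-adj = glued-adj
    ; row-large = λ x → ≤-reflexive (sym (degree x))
    ; row-back = λ x y m → inj₂ (symmetric x y m)
    } , total
    where
    module D₁ = Deficient D₁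
    module D₂ = Deficient D₂
    open Glue D₁.nbr D₂.nbr true D₁.nbr-unique D₁.nbr-irreflexive D₂.nbr-unique D₂.nbr-irreflexive
    degree : ∀ x → length (glued x) ≡ k
    degree (inj₁ i) = trans (length-glued₁ i) (D₁.nbr-degree i)
    degree (inj₂ j) = trans (length-glued₂ j) (D₂.nbr-degree j)
    symmetric : ∀ x y → y ∈ glued x → x ∈ glued y
    symmetric x y m with ∈-glued⁻ x y m
    ... | clique₁ {i} {j} mj = ∈-glued₁ j i (D₁.nbr-symmetric i j mj)
    ... | clique₂ {i} {j} mj = ∈-glued₂ j i (D₂.nbr-symmetric i j mj)
    ... | cut₁ t = ∈-glued-cut₂ t
    ... | cut₂ t = ∈-glued-cut₁ t
    total : sumOver (λ x → length (glued x)) vertices ≡ k * (n + m)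
    total = begin
      sumOver (λ x → length (glued x)) vertices ≡⟨ sumOver-const k _ vertices (λ x _ → degree x) ⟩
      k * length vertices                       ≡⟨ cong (k *_) length-vertices ⟩
      k * (n + m)                               ∎
      where open ≡-Reasoning

odd-product : ∀ M N → parity M ≡ 1ℙ → parity N ≡ 1ℙ → parity (M * N) ≡ 1ℙ
odd-product M N odd-M odd-N = trans (*-homo-* M N) (cong₂ _*ℙ_ odd-M odd-N)

odd-product-factors : ∀ M N → parity (M * N) ≡ 1ℙ → parity M ≡ 1ℙ × parity N ≡ 1ℙ
odd-product-factors M N odd = factors (parity M) (parity N) (trans (sym (*-homo-* M N)) odd)
  where
  factors : ∀ p q → p *ℙ q ≡ 1ℙ → p ≡ 1ℙ × q ≡ 1ℙ
  factors 1ℙ 1ℙ _ = refl , refl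
  factors 0ℙ q ()
  factors 1ℙ 0ℙ ()

-- If k, n, m are all odd, glue deficient systems through the cut-edge; otherwise
-- k n and k m are not both odd and optimal systems on the cliques suffice.
bridge-rows : ∀ n m k → k < n → n ≤ m → (a : Fin n) (b : Fin m) → let open BridgeGraph n m a b in
  Σ[ R ∈ Rows F k ] sumOver (λ x → length (Rows.row R x)) vertices ≡ ⌈ k * (n + m) ⌉₂
bridge-rows n m k k<n n≤m a b with (parity k ≟ℙ 1ℙ) ×-dec (parity n ≟ℙ 1ℙ) ×-dec (parity m ≟ℙ 1ℙ)
... | yes (odd-k , odd-n , odd-m) = R , trans size (sym (⌈⌉₂-even (k * (n + m)) even))
  where
  open BridgeGraph n m a b
  joined : Σ[ R ∈ Rows F k ] sumOver (λ x → length (Rows.row R x)) vertices ≡ k * (n + m)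
  joined = joined-rows (deficient-rows n k k<n odd-k odd-n a) (deficient-rows m k (<-≤-trans k<n n≤m) odd-k odd-m b)
  R : Rows F k
  R = proj₁ joined
  size : sumOver (λ x → length (Rows.row R x)) vertices ≡ k * (n + m)
  size = proj₂ joined
  even : parity (k * (n + m)) ≡ 0ℙ
  even = trans (*-homo-* k (n + m)) (cong₂ _*ℙ_ odd-k (trans (+-homo-+ n m) (cong₂ _+ℙ_ odd-n odd-m)))
... | no not-all-odd = R , size
  where
  open BridgeGraph n m a b
  on-G : Σ[ R ∈ Rows (K n) k ] totalK R ≡ ⌈ k * n ⌉₂
  on-G = complete-rows n k k<n
  on-H : Σ[ R ∈ Rows (K m) k ] totalK R ≡ ⌈ k * m ⌉₂
  on-H = complete-rows m k (<-≤-trans k<n n≤m)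
  separate : Σ[ R ∈ Rows F k ] sumOver (λ x → length (Rows.row R x)) vertices ≡ totalK (proj₁ on-G) + totalK (proj₁ on-H)
  separate = separate-rows (proj₁ on-G) (proj₁ on-H)
  R : Rows F k
  R = proj₁ separate
  not-both : parity (k * n) ≡ 1ℙ × parity (k * m) ≡ 1ℙ → ⊥
  not-both (odd-kn , odd-km) =
    not-all-odd (proj₁ (odd-product-factors k n odd-kn) , proj₂ (odd-product-factors k n odd-kn) ,
                 proj₂ (odd-product-factors k m odd-km))
  size : sumOver (λ x → length (Rows.row R x)) vertices ≡ ⌈ k * (n + m) ⌉₂
  size = begin
    sumOver (λ x → length (Rows.row R x)) vertices ≡⟨ proj₂ separate ⟩
    totalK (proj₁ on-G) + totalK (proj₁ on-H)      ≡⟨ cong₂ _+_ (proj₂ on-G) (proj₂ on-H) ⟩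
    ⌈ k * n ⌉₂ + ⌈ k * m ⌉₂                        ≡⟨ ⌈⌉₂-+ (k * n) (k * m) not-both ⟨
    ⌈ k * n + k * m ⌉₂                             ≡⟨ cong ⌈_⌉₂ (*-distribˡ-+ k n m) ⟨
    ⌈ k * (n + m) ⌉₂                               ∎
    where open ≡-Reasoning

bridge-neighbour : ∀ n' m' (a : Fin (suc (suc n'))) (b : Fin (suc (suc m'))) →
  let F = Bridge (suc (suc n')) (suc (suc m')) a b in ∀ x → Σ (V F) (λ y → T (adj F x y))
bridge-neighbour n' m' a b (inj₁ i) = inj₁ (proj₁ (K-neighbour n' i)) , proj₂ (K-neighbour n' i)
bridge-neighbour n' m' a b (inj₂ j) = inj₂ (proj₁ (K-neighbour m' j)) , proj₂ (K-neighbour m' j)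

γ-bridge : ∀ n m k → 2 ≤ k → k < n → n ≤ m → (a : Fin n) (b : Fin m) →
  IsγKT (Inflated (Bridge n m a b)) k ⌈ k * (n + m) ⌉₂
γ-bridge n@(suc (suc n')) m@(suc (suc m')) k 2≤k k<n n≤m a b with bridge-rows n m k k<n n≤m a b
... | R , optimal =
  subst (λ N → IsγKT (Inflated F) k ⌈ k * N ⌉₂) length-vertices
    (Inflation.γ-by-rows F F-simple k 2≤k (bridge-neighbour n' m' a b) R
      (trans optimal (cong (λ N → ⌈ k * N ⌉₂) (sym length-vertices))))
  where open BridgeGraph n m a b
γ-bridge (suc zero) m (suc (suc k)) 2≤k (s≤s ()) n≤m a b
γ-bridge (suc (suc n')) (suc zero) k 2≤k k<n (s≤s ()) a b

γ-unique : ∀ G k {s t} → IsγKT G k s → IsγKT G k t → s ≡ t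
γ-unique G k ((S , ktds , |S|≡s) , s-least) ((S' , ktds' , |S'|≡t) , t-least) =
  ≤-antisym (subst (_ ≤_) |S'|≡t (s-least S' ktds')) (subst (_ ≤_) |S|≡s (t-least S ktds))

corollary3p5 : (k n m : ℕ) → 2 ≤ k → k < n → n ≤ m →
    (a : Fin n) (b : Fin m) (γG γH : ℕ) →
    IsγKT (Inflated (K n)) k γG → IsγKT (Inflated (K m)) k γH →
    ((Odd k × Odd n × Odd m) → IsγKT (Inflated (Bridge n m a b)) k (γG + γH ∸ 2))
    × (¬ (Odd k × Odd n × Odd m) → IsγKT (Inflated (Bridge n m a b)) k (γG + γH))
corollary3p5 k n m 2≤k k<n n≤m a b γG γH isγG isγH = all-odd , not-all-odd
  where
  γG≡ : γG ≡ ⌈ k * n ⌉₂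
  γG≡ = γ-unique (Inflated (K n)) k isγG (γ-complete n k 2≤k k<n)
  γH≡ : γH ≡ ⌈ k * m ⌉₂
  γH≡ = γ-unique (Inflated (K m)) k isγH (γ-complete m k 2≤k (<-≤-trans k<n n≤m))
  γF : IsγKT (Inflated (Bridge n m a b)) k ⌈ k * n + k * m ⌉₂
  γF = subst (λ N → IsγKT (Inflated (Bridge n m a b)) k ⌈ N ⌉₂) (*-distribˡ-+ k n m) (γ-bridge n m k 2≤k k<n n≤m a b)
  all-odd : Odd k × Odd n × Odd m → IsγKT (Inflated (Bridge n m a b)) k (γG + γH ∸ 2)
  all-odd (odd-k , odd-n , odd-m) = subst (IsγKT (Inflated (Bridge n m a b)) k)
    (trans (⌈⌉₂-+-odd (k * n) (k * m) (odd-product k n (Odd⇒parity k odd-k) (Odd⇒parity n odd-n))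
                                      (odd-product k m (Odd⇒parity k odd-k) (Odd⇒parity m odd-m)))
           (sym (cong₂ (λ g h → g + h ∸ 2) γG≡ γH≡))) γF
  not-all-odd : ¬ (Odd k × Odd n × Odd m) → IsγKT (Inflated (Bridge n m a b)) k (γG + γH)
  not-all-odd not-odd = subst (IsγKT (Inflated (Bridge n m a b)) k)
    (trans (⌈⌉₂-+ (k * n) (k * m) not-both) (sym (cong₂ _+_ γG≡ γH≡))) γF
    where
    not-both : parity (k * n) ≡ 1ℙ × parity (k * m) ≡ 1ℙ → ⊥
    not-both (odd-kn , odd-km) = not-odd (parity⇒Odd k (proj₁ (odd-product-factors k n odd-kn)) ,
      parity⇒Odd n (proj₂ (odd-product-factors k n odd-kn)) , parity⇒Odd m (proj₂ (odd-product-factors k m odd-km)))
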